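{- Fix an integer $r\ge0$ and let $P=(p_{ij})_{i,j\ge0}$ be an $(r,1)$-banded matrix with entries in a commutative ring $R$ containing the rationals. Let $\xi$ be an indeterminate and $B_\xi=(\binom{i}{j}\xi^{i-j})_{i,j\ge0}$, regarded as a matrix over $R[\xi]$. The following are equivalent: (a) $B_\xi^{ -1}PB_\xi$ is $(r,1)$-banded; (b) the $(r+1)$st subdiagonal of $B_\xi^{ -1}PB_\xi$ vanishes, i.e. $(B_\xi^{ -1}PB_\xi)_{n+r+1,n}=0$ for all $n\ge0$; (c) there is a polynomial $f_{ -1}$ of degree at most $r$ with coefficients in $R$ such that $p_{n,n+1}=f_{ -1}(n)$ for all $n\ge0$, and for each $0\le m\le r$ there is a polynomial $f_m$ of degree at most $r-m$ with coefficients in $R$ such that $p_{n,n-m}=n(n-1)\cdots(n-m+1)\,f_m(n)$ for all $n\ge m$.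
   Context: A matrix $A=(a_{ij})_{i,j\ge0}$ is $(r,s)$-banded if $a_{ij}=0$ whenever $j<i-r$ or $j>i+s$. -}

module Defs where

open import Level using (Level; _⊔_)
open import Algebra.Bundles using (CommutativeRing)
open import Data.Nat using (ℕ; zero; suc; _≤_; _<_; _≤?_; _≟_; _∸_) renaming (_+_ to _+ℕ_)
open import Data.Nat.Combinatorics using (_C_)
open import Data.Vec using (Vec; []; _∷_)
open import Data.Product using (Σ; _×_; _,_; ∃)
open import Data.Sum using (_⊎_)
open import Function.Bundles using (_⇔_)
open import Relation.Nullary using (yes; no)

module _ {c ℓ : Level} (R : CommutativeRing c ℓ) where
  open CommutativeRing R using (_≈_; _+_; _*_; -_; 0#; 1#) renaming (Carrier to A)

  ι : ℕ → A
  ι zero    = 0#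
  ι (suc n) = 1# + ι n

  -- "R contains the rationals": every positive integer is invertible in R
  ContainsRationals : Set (c ⊔ ℓ)
  ContainsRationals = ∀ n → Σ A λ y → ι (suc n) * y ≈ 1#

  sumR : ℕ → (ℕ → A) → A
  sumR zero    f = f zero
  sumR (suc n) f = sumR n f + f (suc n)

  prodR : ℕ → (ℕ → A) → A
  prodR zero    f = 1#
  prodR (suc m) f = prodR m f * f m

  falling : ℕ → ℕ → A
  falling n m = prodR m (λ i → ι (n ∸ i))

  -- a polynomial with coefficients in R of degree ≤ d is a coefficient vector
  -- (a₀,…,a_d); evaluation by Horner's rule: a₀ + x(a₁ + x(…))
  eval : ∀ {d} → Vec A d → A → A
  eval []       x = 0#
  eval (a ∷ as) x = a + x * eval as x

  -- The polynomial ring R[ξ], elements given by coefficient sequences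
  -- (coefficient of ξ^k), with coefficientwise equality.
  Poly : Set c
  Poly = ℕ → A

  _≈P_ : Poly → Poly → Set ℓ
  f ≈P g = ∀ k → f k ≈ g k

  0P : Poly
  0P _ = 0#

  constP : A → Poly
  constP a zero    = a
  constP a (suc _) = 0#

  ξ : Poly
  ξ 1 = 1#
  ξ _ = 0#

  _+P_ : Poly → Poly → Poly
  (f +P g) k = f k + g k

  _*P_ : Poly → Poly → Poly
  (f *P g) k = sumR k (λ i → f i * g (k ∸ i))

  -P_ : Poly → Poly
  (-P f) k = - f k

  _^P_ : Poly → ℕ → Poly
  f ^P zero  = constP 1#
  f ^P suc n = (f ^P n) *P f

  sumP : ℕ → (ℕ → Poly) → Poly
  sumP zero    f = f zero
  sumP (suc n) f = sumP n f +P f (suc n)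

  Matrix : ∀ {b} → Set b → Set b
  Matrix B = ℕ → ℕ → B

  Banded : ∀ {b z} {B : Set b} → (B → Set z) → ℕ → ℕ → Matrix B → Set z
  Banded isZero r s M = ∀ i j → (j +ℕ r < i ⊎ i +ℕ s < j) → isZero (M i j)

  IsZeroR : A → Set ℓ
  IsZeroR a = a ≈ 0#

  IsZeroP : Poly → Set ℓ
  IsZeroP p = p ≈P 0P

  LowerTriangular : Matrix Poly → Set ℓ
  LowerTriangular M = ∀ i j → i < j → IsZeroP (M i j)

  Bξ : Matrix Poly
  Bξ i j with j ≤? i
  ... | yes _ = constP (ι (i C j)) *P (ξ ^P (i ∸ j))
  ... | no  _ = 0P

  IdP : Matrix Poly
  IdP i j with i ≟ j
  ... | yes _ = constP 1#
  ... | no  _ = 0P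

  -- Product L·M of a lower-triangular L with M: (LM)_ij = Σ_{k=0}^{i} L_ik M_kj
  -- (exact, since L_ik = 0 for k > i).
  _⋆ᴸ_ : Matrix Poly → Matrix Poly → Matrix Poly
  (L ⋆ᴸ M) i j = sumP i (λ k → L i k *P M k j)

  -- Product P·M of a matrix P over R with p_kl = 0 for l > k+1 (as P is
  -- (r,1)-banded), entries embedded as constants in R[ξ]:
  -- (PM)_kj = Σ_{l=0}^{k+1} p_kl M_lj  (exact under that hypothesis).
  _⋆ᵁ_ : Matrix A → Matrix Poly → Matrix Poly
  (P ⋆ᵁ M) k j = sumP (suc k) (λ l → constP (P k l) *P M l j)

  -- B_ξ⁻¹ P B_ξ, where Binv is the (lower-triangular) inverse of B_ξ
  conj : Matrix Poly → Matrix A → Matrix Poly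
  conj Binv P = Binv ⋆ᴸ (P ⋆ᵁ Bξ)

  CondA : ℕ → Matrix Poly → Matrix A → Set ℓ
  CondA r Binv P = Banded IsZeroP r 1 (conj Binv P)

  CondB : ℕ → Matrix Poly → Matrix A → Set ℓ
  CondB r Binv P = ∀ n → IsZeroP (conj Binv P (n +ℕ r +ℕ 1) n)

  CondC : ℕ → Matrix A → Set (c ⊔ ℓ)
  CondC r P =
    (Σ (Vec A (suc r)) λ f₋₁ → ∀ n → P n (suc n) ≈ eval f₋₁ (ι n))
    × (∀ m → m ≤ r →
         Σ (Vec A (suc (r ∸ m))) λ fₘ →
           ∀ n → m ≤ n → P n (n ∸ m) ≈ falling n m * eval fₘ (ι n))

-- Write c = j + t.  Since B_ξ is unitriangular, B_ξ⁻¹ = B_{-ξ}, and the ξ^t-coefficient of the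
-- (i, j) entry of B_ξ⁻¹ P B_ξ is Σ_k (-1)^(i-k) C(i,k) p_{k,l} C(l,j) with l = k + c - i: the i-th
-- finite difference at 0 of k ↦ C(l,j) p_{k,l}, a binomial weight times one diagonal of P.  If that
-- diagonal is a polynomial of the degree allowed in (c), this function has degree at most j + r,
-- which is below i outside the band, so the difference vanishes: (c) ⇒ (a).  Conversely the
-- (r+1)st subdiagonal gives, for each diagonal, a recurrence whose leading coefficient is a
-- positive integer, hence a unit.  The polynomial interpolating the diagonal on [0, r] solves the
-- same recurrence by the degree argument, so the two agree everywhere: (b) ⇒ (c).
module Submission where

open import Defs
open import Level using (Level; _⊔_)
open import Algebra.Bundles using (CommutativeRing)
open import Data.Nat using (ℕ; zero; suc; z≤n; s≤s; _≤_; _<_; _≤?_; _<?_; _≟_; _∸_)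
  renaming (_+_ to _+ℕ_; _*_ to _*ℕ_)
import Data.Nat.Properties as ℕ
open import Data.Nat.Combinatorics using (_C_; k>n⇒nCk≡0; nCn≡1)
open import Data.Nat.Combinatorics.Base using (_P′_)
open import Data.Product using (Σ; _×_; _,_; proj₁; proj₂)
open import Data.Sum using (_⊎_; inj₁; inj₂)
open import Data.Vec using (Vec; []; _∷_)
open import Data.Empty using (⊥-elim)
open import Function.Base using (_∘_)
open import Function.Bundles using (_⇔_; mk⇔)
open import Relation.Nullary using (Dec; yes; no)
open import Relation.Binary.PropositionalEquality as ≡ using (_≡_; _≢_)

module Binomial where

  open import Data.Nat.Base
  open import Data.Nat.Properties
  open import Data.Nat.Combinatorics using (nC1≡n; nCk+nC[k+1]≡[n+1]C[k+1])
  open import Relation.Binary.PropositionalEquality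
  open import Algebra.Properties.CommutativeSemigroup *-commutativeSemigroup
    using (x∙yz≈xz∙y; xy∙z≈xz∙y)
  open ≡-Reasoning

  pascal : ∀ n k → suc n C suc k ≡ n C k + n C suc k
  pascal n k = sym (nCk+nC[k+1]≡[n+1]C[k+1] n k)

  C-absorption : ∀ n k → (suc n C suc k) * suc k ≡ (n C k) * suc n
  C-absorption zero    zero    = refl
  C-absorption zero    (suc k) =
    cong₂ _*_ (k>n⇒nCk≡0 {1} {suc (suc k)} (s≤s (s≤s z≤n))) (k>n⇒nCk≡0 {0} {suc k} (s≤s z≤n))
  C-absorption (suc n) zero    =
    trans (*-identityʳ _) (trans (nC1≡n (suc (suc n))) (sym (*-identityˡ (suc (suc n)))))
  C-absorption (suc n) (suc k) = begin
    (suc (suc n) C suc (suc k)) * suc (suc k)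
      ≡⟨ cong (_* suc (suc k)) (pascal (suc n) (suc k)) ⟩
    (a + b) * suc (suc k)
      ≡⟨ *-distribʳ-+ (suc (suc k)) a b ⟩
    a * suc (suc k) + b * suc (suc k)
      ≡⟨ cong₂ _+_ (*-suc a (suc k)) (C-absorption n (suc k)) ⟩
    a + a * suc k + (n C suc k) * suc n
      ≡⟨ cong (λ x → a + x + (n C suc k) * suc n) (C-absorption n k) ⟩
    a + (n C k) * suc n + (n C suc k) * suc n
      ≡⟨ +-assoc a _ _ ⟩
    a + ((n C k) * suc n + (n C suc k) * suc n)
      ≡⟨ cong (a +_) (*-distribʳ-+ (suc n) (n C k) (n C suc k)) ⟨
    a + (n C k + n C suc k) * suc n
      ≡⟨ cong (λ x → a + x * suc n) (pascal n k) ⟨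
    a + a * suc n
      ≡⟨ *-suc a (suc n) ⟨
    a * suc (suc n) ∎
    where
    a b : ℕ
    a = suc n C suc k
    b = suc n C suc (suc k)

  -- As (k P′ m) = m! C(k, m), this is C(k-m, n) C(k, m) = C(k, n+m) C(n+m, m).
  C-fallingFactorial : ∀ m n k → ((k ∸ m) C n) * (k P′ m) ≡ (k C (n + m)) * ((n + m) P′ m)
  C-fallingFactorial zero    n k = cong (λ x → (k C x) * 1) (sym (+-identityʳ n))
  C-fallingFactorial (suc m) n k with k ∸ m in k∸m≡
  ... | zero = begin
    ((k ∸ suc m) C n) * 0                      ≡⟨ *-zeroʳ ((k ∸ suc m) C n) ⟩
    0                                          ≡⟨ cong (_* ((n + suc m) P′ suc m)) (k>n⇒nCk≡0 k<n+1+m) ⟨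
    (k C (n + suc m)) * ((n + suc m) P′ suc m)   ∎
    where
    k<n+1+m : k < n + suc m
    k<n+1+m = ≤-trans (s≤s (m∸n≡0⇒m≤n k∸m≡)) (m≤n+m (suc m) n)
  ... | suc x = begin
    ((k ∸ suc m) C n) * (suc x * (k P′ m))      ≡⟨ cong (λ y → (y C n) * (suc x * (k P′ m))) k∸1+m≡x ⟩
    (x C n) * (suc x * (k P′ m))                ≡⟨ *-assoc (x C n) (suc x) (k P′ m) ⟨
    ((x C n) * suc x) * (k P′ m)                ≡⟨ cong (_* (k P′ m)) (C-absorption x n) ⟨
    ((suc x C suc n) * suc n) * (k P′ m)        ≡⟨ xy∙z≈xz∙y (suc x C suc n) (suc n) (k P′ m) ⟩
    ((suc x C suc n) * (k P′ m)) * suc n        ≡⟨ cong (λ y → ((y C suc n) * (k P′ m)) * suc n) k∸m≡ ⟨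
    (((k ∸ m) C suc n) * (k P′ m)) * suc n      ≡⟨ cong (_* suc n) (C-fallingFactorial m (suc n) k) ⟩
    ((k C (suc n + m)) * ((suc n + m) P′ m)) * suc n
      ≡⟨ cong (λ y → ((k C y) * (y P′ m)) * suc n) (sym (+-suc n m)) ⟩
    ((k C (n + suc m)) * ((n + suc m) P′ m)) * suc n
      ≡⟨ x∙yz≈xz∙y (k C (n + suc m)) (suc n) ((n + suc m) P′ m) ⟨
    (k C (n + suc m)) * (suc n * ((n + suc m) P′ m))
      ≡⟨ cong (λ y → (k C (n + suc m)) * (y * ((n + suc m) P′ m))) n+1+m∸m≡1+n ⟨
    (k C (n + suc m)) * ((n + suc m) P′ suc m) ∎
    where
    k∸1+m≡x : k ∸ suc m ≡ x
    k∸1+m≡x = trans (sym (pred[m∸n]≡m∸[1+n] k m)) (cong pred k∸m≡)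
    n+1+m∸m≡1+n : (n + suc m) ∸ m ≡ suc n
    n+1+m∸m≡1+n = trans (cong (_∸ m) (+-suc n m)) (m+n∸n≡m (suc n) m)

  C-pos : ∀ {n k} → k ≤ n → 0 < n C k
  C-pos {n}     {zero}  _         = s≤s z≤n
  C-pos {suc n} {suc k} (s≤s k≤n) = subst (0 <_) (sym (pascal n k)) (≤-trans (C-pos k≤n) (m≤m+n _ _))

module NatArithmetic where

  open import Data.Nat.Base
  open import Data.Nat.Properties
  open import Relation.Binary.PropositionalEquality

  m∸n+n∸o≡m∸o : ∀ {m n o} → n ≤ m → o ≤ n → (m ∸ n) + (n ∸ o) ≡ m ∸ o
  m∸n+n∸o≡m∸o {m}     {n}     {zero}  n≤m       z≤n       = m∸n+n≡m n≤m
  m∸n+n∸o≡m∸o {suc m} {suc n} {suc o} (s≤s n≤m) (s≤s o≤n) = m∸n+n∸o≡m∸o n≤m o≤n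

  column-index : ∀ {i k t} j → k ≤ i → i ∸ k ≤ t → j + (t ∸ (i ∸ k)) + i ≡ k + (j + t)
  column-index {i} {k} {t} j k≤i d≤t = begin
    j + (t ∸ d) + i              ≡⟨ cong (j + (t ∸ d) +_) (m+[n∸m]≡n k≤i) ⟨
    j + (t ∸ d) + (k + d)        ≡⟨ reorder j (t ∸ d) k d ⟩
    k + (j + (d + (t ∸ d)))      ≡⟨ cong (λ x → k + (j + x)) (m+[n∸m]≡n d≤t) ⟩
    k + (j + t)                  ∎
    where
    open ≡-Reasoning
    d : ℕ
    d = i ∸ k
    reorder : ∀ j u k d → j + u + (k + d) ≡ k + (j + (d + u))
    reorder = solve-∀
      where open import Data.Nat.Tactic.RingSolver

  below-column-index : ∀ {i k t} j → k ≤ i → t < i ∸ k → k + (j + t) < i + j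
  below-column-index {i} {k} {t} j k≤i t<i∸k = begin-strict
    k + (j + t)     ≡⟨ +-comm k (j + t) ⟩
    j + t + k       ≡⟨ +-assoc j t k ⟩
    j + (t + k)     <⟨ +-monoʳ-< j (+-monoˡ-< k t<i∸k) ⟩
    j + (i ∸ k + k) ≡⟨ cong (j +_) (m∸n+n≡m k≤i) ⟩
    j + i           ≡⟨ +-comm j i ⟩
    i + j           ∎
    where open ≤-Reasoning

  superdiagonal-column : ∀ {i k l c} → c ≡ suc i → l + i ≡ k + c → l ≡ suc k
  superdiagonal-column {i} {k} {l} c≡1+i l+i≡k+c =
    +-cancelʳ-≡ i l (suc k) (trans l+i≡k+c (trans (cong (k +_) c≡1+i) (+-suc k i)))

  superdiagonal-below : ∀ {i j k c} → c ≡ suc i → k + c < i + j → suc k < j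
  superdiagonal-below {i} {j} {k} c≡1+i k+c<i+j =
    +-cancelʳ-< i (suc k) j (subst₂ _<_ (trans (cong (k +_) c≡1+i) (+-suc k i)) (+-comm i j) k+c<i+j)

  beyondBand-column : ∀ {i k l c} → suc (suc i) ≤ c → l + i ≡ k + c → k + 1 < l
  beyondBand-column {i} {k} {l} {c} 2+i≤c l+i≡k+c = +-cancelʳ-≤ i (suc (k + 1)) l (begin
    suc (k + 1) + i    ≡⟨ reorder k i ⟩
    k + suc (suc i)    ≤⟨ +-monoʳ-≤ k 2+i≤c ⟩
    k + c              ≡⟨ l+i≡k+c ⟨
    l + i              ∎)
    where
    open ≤-Reasoning
    reorder : ∀ k i → suc (k + 1) + i ≡ k + suc (suc i)
    reorder = solve-∀
      where open import Data.Nat.Tactic.RingSolver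

  subdiagonal-column : ∀ {i k l m c} → i ≡ m + c → l + i ≡ k + c → l + m ≡ k
  subdiagonal-column {i} {k} {l} {m} {c} i≡m+c l+i≡k+c =
    +-cancelʳ-≡ c (l + m) k (trans (+-assoc l m c) (trans (cong (l +_) (sym i≡m+c)) l+i≡k+c))

  subdiagonal-below : ∀ {i j k m c} → i ≡ m + c → k + c < i + j → k < j + m
  subdiagonal-below {i} {j} {k} {m} {c} i≡m+c k+c<i+j =
    +-cancelʳ-< c k (j + m) (subst (k + c <_) (trans (cong (_+ j) i≡m+c) (reorder m c j)) k+c<i+j)
    where
    reorder : ∀ m c j → m + c + j ≡ j + m + c
    reorder = solve-∀
      where open import Data.Nat.Tactic.RingSolver

  m∸[1+n]+n+1≡m : ∀ {m n} → n < m → m ∸ suc n + n + 1 ≡ m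
  m∸[1+n]+n+1≡m {m} {n} n<m = trans (+-assoc (m ∸ suc n) n 1) (trans (cong (m ∸ suc n +_) (+-comm n 1)) (m∸n+n≡m n<m))

  j+m+[r∸m]≡j+r : ∀ j {m r} → m ≤ r → j + m + (r ∸ m) ≡ j + r
  j+m+[r∸m]≡j+r j {m} m≤r = trans (+-assoc j m _) (cong (j +_) (m+[n∸m]≡n m≤r))

  n+r+1≡1+[n+r] : ∀ n r → n + r + 1 ≡ suc (n + r)
  n+r+1≡1+[n+r] n r = +-comm (n + r) 1

  n+[r+2]≡1+[n+r+1] : ∀ n r → n + suc (suc r) ≡ suc (n + r + 1)
  n+[r+2]≡1+[n+r+1] = solve-∀
    where open import Data.Nat.Tactic.RingSolver

  n+r+1≡m+[n+1+[r∸m]] : ∀ n {m r} → m ≤ r → n + r + 1 ≡ m + (n + suc (r ∸ m))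
  n+r+1≡m+[n+1+[r∸m]] n {m} {r} m≤r = begin
    n + r + 1                ≡⟨ cong (λ x → n + x + 1) (m+[n∸m]≡n m≤r) ⟨
    n + (m + (r ∸ m)) + 1    ≡⟨ reorder n m (r ∸ m) ⟩
    m + (n + suc (r ∸ m))    ∎
    where
    open ≡-Reasoning
    reorder : ∀ n m d → n + (m + d) + 1 ≡ m + (n + suc d)
    reorder = solve-∀
      where open import Data.Nat.Tactic.RingSolver

  n+m≤n+r+1 : ∀ n {m r} → m ≤ r → n + m ≤ n + r + 1
  n+m≤n+r+1 n {r = r} m≤r = ≤-trans (+-monoʳ-≤ n m≤r) (m≤m+n (n + r) 1)

  n≤n+r+1∸m : ∀ n {m r} → m ≤ r → n ≤ n + r + 1 ∸ m
  n≤n+r+1∸m n {m} {r} m≤r = subst (n ≤_) (sym n+r+1∸m≡n+1+[r∸m]) (m≤m+n n (suc (r ∸ m)))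
    where
    n+r+1∸m≡n+1+[r∸m] : n + r + 1 ∸ m ≡ n + suc (r ∸ m)
    n+r+1∸m≡n+1+[r∸m] = trans (cong (_∸ m) (n+r+1≡m+[n+1+[r∸m]] n m≤r)) (m+n∸m≡n m (n + suc (r ∸ m)))

module RingLemmas {c ℓ : Level} (R : CommutativeRing c ℓ) where

  open CommutativeRing R public hiding (zero) renaming (Carrier to A)
  open import Algebra.Properties.Ring ring public
  open import Algebra.Properties.CommutativeSemigroup +-commutativeSemigroup public
    using () renaming (interchange to +-interchange; x∙yz≈y∙xz to x+[y+z]≈y+[x+z])
  open import Algebra.Properties.CommutativeSemigroup *-commutativeSemigroup public
    using () renaming (interchange to *-interchange; x∙yz≈y∙xz to x*[y*z]≈y*[x*z])
  open import Relation.Binary.Reasoning.Setoid setoid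

  ≈0-+ : ∀ {x y} → x ≈ 0# → y ≈ 0# → x + y ≈ 0#
  ≈0-+ x≈0 y≈0 = trans (+-cong x≈0 y≈0) (+-identityʳ 0#)

  ≈0-*ˡ : ∀ {x} y → x ≈ 0# → x * y ≈ 0#
  ≈0-*ˡ y x≈0 = trans (*-congʳ x≈0) (zeroˡ y)

  ≈0-*ʳ : ∀ x {y} → y ≈ 0# → x * y ≈ 0#
  ≈0-*ʳ x y≈0 = trans (*-congˡ y≈0) (zeroʳ x)

  ≈0-‿ : ∀ {x} → x ≈ 0# → - x ≈ 0#
  ≈0-‿ x≈0 = trans (-‿cong x≈0) -0#≈0#

  sumR-cong : ∀ n {f g} → (∀ k → k ≤ n → f k ≈ g k) → sumR R n f ≈ sumR R n g
  sumR-cong zero    f≈g = f≈g 0 z≤n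
  sumR-cong (suc n) f≈g = +-cong (sumR-cong n (λ k k≤n → f≈g k (ℕ.m≤n⇒m≤1+n k≤n))) (f≈g (suc n) ℕ.≤-refl)

  sumR-≈0 : ∀ n {f} → (∀ k → k ≤ n → f k ≈ 0#) → sumR R n f ≈ 0#
  sumR-≈0 zero    f≈0 = f≈0 0 z≤n
  sumR-≈0 (suc n) f≈0 = ≈0-+ (sumR-≈0 n (λ k k≤n → f≈0 k (ℕ.m≤n⇒m≤1+n k≤n))) (f≈0 (suc n) ℕ.≤-refl)

  sumR-+ : ∀ n f g → sumR R n (λ k → f k + g k) ≈ sumR R n f + sumR R n g
  sumR-+ zero    f g = refl
  sumR-+ (suc n) f g = trans (+-congʳ (sumR-+ n f g)) (+-interchange _ _ _ _)

  sumR-‿ : ∀ n f → sumR R n (λ k → - f k) ≈ - sumR R n f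
  sumR-‿ zero    f = refl
  sumR-‿ (suc n) f = trans (+-congʳ (sumR-‿ n f)) (-‿+-comm _ _)

  sumR-- : ∀ n f g → sumR R n (λ k → f k - g k) ≈ sumR R n f - sumR R n g
  sumR-- n f g = trans (sumR-+ n f (λ k → - g k)) (+-congˡ (sumR-‿ n g))

  sumR-head : ∀ n f → sumR R (suc n) f ≈ f 0 + sumR R n (f ∘ suc)
  sumR-head zero    f = refl
  sumR-head (suc n) f = trans (+-congʳ (sumR-head n f)) (+-assoc _ _ _)

  sumR-single : ∀ n {f} j → j ≤ n → (∀ k → k ≤ n → k ≢ j → f k ≈ 0#) → sumR R n f ≈ f j
  sumR-single zero    zero j≤n others≈0 = refl
  sumR-single (suc n) j j≤n others≈0 with j ≟ suc n
  ... | yes ≡.refl = trans (+-congʳ (sumR-≈0 n (λ k k≤n → others≈0 k (ℕ.m≤n⇒m≤1+n k≤n) (ℕ.<⇒≢ (s≤s k≤n)))))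
                           (+-identityˡ _)
  ... | no j≢1+n = trans (+-cong (sumR-single n j (ℕ.≤-pred (ℕ.≤∧≢⇒< j≤n j≢1+n))
                                                  (λ k k≤n → others≈0 k (ℕ.m≤n⇒m≤1+n k≤n)))
                                 (others≈0 (suc n) ℕ.≤-refl (j≢1+n ∘ ≡.sym)))
                         (+-identityʳ _)

  signed : ℕ → A → A
  signed zero    x = x
  signed (suc e) x = - signed e x

  signed-cong : ∀ e {x y} → x ≈ y → signed e x ≈ signed e y
  signed-cong zero    x≈y = x≈y
  signed-cong (suc e) x≈y = -‿cong (signed-cong e x≈y)

  signed-≈0 : ∀ e {x} → x ≈ 0# → signed e x ≈ 0#
  signed-≈0 zero    x≈0 = x≈0
  signed-≈0 (suc e) x≈0 = ≈0-‿ (signed-≈0 e x≈0)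

  signed-+ : ∀ e x y → signed e (x + y) ≈ signed e x + signed e y
  signed-+ zero    x y = refl
  signed-+ (suc e) x y = trans (-‿cong (signed-+ e x y)) (sym (-‿+-comm _ _))

  signed-*ˡ : ∀ e a x → signed e (a * x) ≈ a * signed e x
  signed-*ˡ zero    a x = refl
  signed-*ˡ (suc e) a x = trans (-‿cong (signed-*ˡ e a x)) (-‿distribʳ-* a _)

  signed-*ʳ : ∀ e x a → signed e x * a ≈ signed e (x * a)
  signed-*ʳ e x a = trans (*-comm _ a) (trans (sym (signed-*ˡ e a x)) (signed-cong e (*-comm a x)))

  signed-‿ : ∀ e x → signed e (- x) ≈ - signed e x
  signed-‿ zero    x = refl
  signed-‿ (suc e) x = -‿cong (signed-‿ e x)

  ι-+ : ∀ m n → ι R (m +ℕ n) ≈ ι R m + ι R n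
  ι-+ zero    n = sym (+-identityˡ _)
  ι-+ (suc m) n = trans (+-congˡ (ι-+ m n)) (sym (+-assoc _ _ _))

  ι-* : ∀ m n → ι R (m *ℕ n) ≈ ι R m * ι R n
  ι-* zero    n = sym (zeroˡ _)
  ι-* (suc m) n = begin
    ι R (n +ℕ m *ℕ n)              ≈⟨ ι-+ n (m *ℕ n) ⟩
    ι R n + ι R (m *ℕ n)           ≈⟨ +-cong (sym (*-identityˡ _)) (ι-* m n) ⟩
    1# * ι R n + ι R m * ι R n     ≈⟨ distribʳ _ _ _ ⟨
    (1# + ι R m) * ι R n           ∎

  ι-1 : ι R 1 ≈ 1#
  ι-1 = +-identityʳ 1#

  ι-≡ : ∀ {m n} → m ≡ n → ι R m ≈ ι R n
  ι-≡ ≡.refl = refl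

  ι-C-diag : ∀ n → ι R (n C n) ≈ 1#
  ι-C-diag n = trans (ι-≡ (nCn≡1 n)) ι-1

  ι-C-≈0 : ∀ {n k} → n < k → ι R (n C k) ≈ 0#
  ι-C-≈0 n<k = ι-≡ (k>n⇒nCk≡0 n<k)

  Unit : A → Set (c ⊔ ℓ)
  Unit a = Σ A λ b → a * b ≈ 1#

  unit-cong : ∀ {a b} → a ≈ b → Unit a → Unit b
  unit-cong a≈b (a⁻¹ , aa⁻¹≈1) = a⁻¹ , trans (*-congʳ (sym a≈b)) aa⁻¹≈1

  unit-* : ∀ {a b} → Unit a → Unit b → Unit (a * b)
  unit-* {a} {b} (a⁻¹ , aa⁻¹≈1) (b⁻¹ , bb⁻¹≈1) = a⁻¹ * b⁻¹ , (begin
    (a * b) * (a⁻¹ * b⁻¹)   ≈⟨ *-interchange a b a⁻¹ b⁻¹ ⟩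
    (a * a⁻¹) * (b * b⁻¹)   ≈⟨ *-cong aa⁻¹≈1 bb⁻¹≈1 ⟩
    1# * 1#                 ≈⟨ *-identityˡ 1# ⟩
    1#                      ∎)

  unit-*-inverse : ∀ {a} (u : Unit a) b → a * (proj₁ u * b) ≈ b
  unit-*-inverse {a} (a⁻¹ , aa⁻¹≈1) b = trans (sym (*-assoc a a⁻¹ b)) (trans (*-congʳ aa⁻¹≈1) (*-identityˡ b))

  unit-cancel : ∀ {a x} → Unit a → a * x ≈ 0# → x ≈ 0#
  unit-cancel {a} {x} (a⁻¹ , aa⁻¹≈1) ax≈0 = begin
    x                  ≈⟨ unit-*-inverse (a⁻¹ , aa⁻¹≈1) x ⟨
    a * (a⁻¹ * x)      ≈⟨ x*[y*z]≈y*[x*z] a a⁻¹ x ⟩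
    a⁻¹ * (a * x)      ≈⟨ ≈0-*ʳ a⁻¹ ax≈0 ⟩
    0#                 ∎

module FiniteDifferences {c ℓ : Level} (R : CommutativeRing c ℓ) where

  open RingLemmas R
  open import Relation.Binary.Reasoning.Setoid setoid

  Δ : (ℕ → A) → ℕ → A
  Δ G k = G (suc k) - G k

  -- "G is a polynomial of degree below n", in the form Δⁿ G ≈ 0.
  DegreeBelow : ℕ → (ℕ → A) → Set ℓ
  DegreeBelow zero    G = ∀ k → G k ≈ 0#
  DegreeBelow (suc n) G = DegreeBelow n (Δ G)

  Δ-cong : ∀ {F G} → (∀ k → F k ≈ G k) → ∀ k → Δ F k ≈ Δ G k
  Δ-cong F≈G k = +-cong (F≈G (suc k)) (-‿cong (F≈G k))

  Δ-+ : ∀ F G k → Δ (λ j → F j + G j) k ≈ Δ F k + Δ G k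
  Δ-+ F G k = trans (+-congˡ (sym (-‿+-comm (F k) (G k)))) (+-interchange _ _ _ _)

  Δ-*ˡ : ∀ a F k → Δ (λ j → a * F j) k ≈ a * Δ F k
  Δ-*ˡ a F k = trans (+-congˡ (-‿distribʳ-* a (F k))) (sym (distribˡ a _ _))

  Δ-* : ∀ F G k → Δ (λ j → F j * G j) k ≈ Δ F k * G (suc k) + F k * Δ G k
  Δ-* F G k = begin
    f₁ * g₁ - f₀ * g₀                      ≈⟨ +-congˡ (-‿cong (+-identityˡ _)) ⟨
    f₁ * g₁ - (0# + f₀ * g₀)               ≈⟨ +-congˡ (-‿cong (+-congʳ (-‿inverseʳ (f₀ * g₁)))) ⟨
    f₁ * g₁ - ((f₀ * g₁ - f₀ * g₁) + f₀ * g₀)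
      ≈⟨ +-congˡ (-‿cong (+-assoc (f₀ * g₁) (- (f₀ * g₁)) (f₀ * g₀))) ⟩
    f₁ * g₁ - (f₀ * g₁ + (- (f₀ * g₁) + f₀ * g₀))
      ≈⟨ +-congˡ (sym (-‿+-comm (f₀ * g₁) _)) ⟩
    f₁ * g₁ + (- (f₀ * g₁) + - (- (f₀ * g₁) + f₀ * g₀))
      ≈⟨ +-assoc (f₁ * g₁) _ _ ⟨
    (f₁ * g₁ - f₀ * g₁) - (- (f₀ * g₁) + f₀ * g₀)
      ≈⟨ +-congˡ (trans (sym (-‿+-comm _ _)) (+-congʳ (-‿involutive (f₀ * g₁)))) ⟩
    (f₁ * g₁ - f₀ * g₁) + (f₀ * g₁ - f₀ * g₀)
      ≈⟨ +-cong ([y-z]x≈yx-zx g₁ f₁ f₀) (x[y-z]≈xy-xz f₀ g₁ g₀) ⟨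
    (f₁ - f₀) * g₁ + f₀ * (g₁ - g₀)          ∎
    where
    f₁ g₁ f₀ g₀ : A
    f₁ = F (suc k)
    g₁ = G (suc k)
    f₀ = F k
    g₀ = G k

  degreeBelow-cong : ∀ n {F G} → (∀ k → F k ≈ G k) → DegreeBelow n F → DegreeBelow n G
  degreeBelow-cong zero    F≈G F≈0 k = trans (sym (F≈G k)) (F≈0 k)
  degreeBelow-cong (suc n) F≈G degF = degreeBelow-cong n (Δ-cong F≈G) degF

  degreeBelow-≈0 : ∀ n {F} → (∀ k → F k ≈ 0#) → DegreeBelow n F
  degreeBelow-≈0 zero    F≈0 = F≈0
  degreeBelow-≈0 (suc n) F≈0 = degreeBelow-≈0 n (λ k → trans (Δ-cong F≈0 k) (-‿inverseʳ 0#))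

  degreeBelow-suc : ∀ n {F} → DegreeBelow n F → DegreeBelow (suc n) F
  degreeBelow-suc zero    F≈0  = degreeBelow-≈0 0 (λ k → trans (Δ-cong F≈0 k) (-‿inverseʳ 0#))
  degreeBelow-suc (suc n) degF = degreeBelow-suc n degF

  degreeBelow-≤ : ∀ {m n F} → m ≤ n → DegreeBelow m F → DegreeBelow n F
  degreeBelow-≤ {zero}  {zero}  z≤n       degF = degF
  degreeBelow-≤ {zero}  {suc n} z≤n       degF = degreeBelow-suc n (degreeBelow-≤ {zero} {n} z≤n degF)
  degreeBelow-≤ {suc m} {suc n} (s≤s m≤n) degF = degreeBelow-≤ {m} {n} m≤n degF

  degreeBelow-+ : ∀ n F G → DegreeBelow n F → DegreeBelow n G → DegreeBelow n (λ k → F k + G k)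
  degreeBelow-+ zero    F G degF degG k = ≈0-+ (degF k) (degG k)
  degreeBelow-+ (suc n) F G degF degG =
    degreeBelow-cong n (λ k → sym (Δ-+ F G k)) (degreeBelow-+ n (Δ F) (Δ G) degF degG)

  degreeBelow-*ˡ : ∀ n a F → DegreeBelow n F → DegreeBelow n (λ k → a * F k)
  degreeBelow-*ˡ zero    a F degF k = ≈0-*ʳ a (degF k)
  degreeBelow-*ˡ (suc n) a F degF = degreeBelow-cong n (λ k → sym (Δ-*ˡ a F k)) (degreeBelow-*ˡ n a (Δ F) degF)

  degreeBelow-shift : ∀ n F → DegreeBelow n F → DegreeBelow n (F ∘ suc)
  degreeBelow-shift zero    F degF k = degF (suc k)
  degreeBelow-shift (suc n) F degF = degreeBelow-shift n (Δ F) degF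

  degreeBelow-const : ∀ a → DegreeBelow 1 (λ _ → a)
  degreeBelow-const a k = -‿inverseʳ a

  degreeBelow-* : ∀ m n F G → DegreeBelow (suc m) F → DegreeBelow (suc n) G →
                  DegreeBelow (suc (m +ℕ n)) (λ k → F k * G k)
  degreeBelow-* m n F G degF degG =
    degreeBelow-cong (m +ℕ n) (λ k → sym (Δ-* F G k))
      (degreeBelow-+ (m +ℕ n) _ _ (ΔF-term m degF) (ΔG-term n degG))
    where
    ΔF-term : ∀ m → DegreeBelow (suc m) F → DegreeBelow (m +ℕ n) (λ k → Δ F k * G (suc k))
    ΔF-term zero     degF = degreeBelow-≈0 n (λ k → ≈0-*ˡ _ (degF k))
    ΔF-term (suc m′) degF = degreeBelow-* m′ n (Δ F) (G ∘ suc) degF (degreeBelow-shift (suc n) G degG)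
    ΔG-term : ∀ n → DegreeBelow (suc n) G → DegreeBelow (m +ℕ n) (λ k → F k * Δ G k)
    ΔG-term zero     degG = degreeBelow-≈0 (m +ℕ 0) (λ k → ≈0-*ʳ _ (degG k))
    ΔG-term (suc n′) degG = ≡.subst (λ d → DegreeBelow d (λ k → F k * Δ G k)) (≡.sym (ℕ.+-suc m n′))
                                    (degreeBelow-* m n′ F (Δ G) degF degG)

  -- (Δᴺ G)(0), by finiteDiff-suc
  finiteDiff : ℕ → (ℕ → A) → A
  finiteDiff N G = sumR R N (λ k → signed (N ∸ k) (ι R (N C k) * G k))

  finiteDiff-cong : ∀ N {F G} → (∀ k → k ≤ N → F k ≈ G k) → finiteDiff N F ≈ finiteDiff N G
  finiteDiff-cong N F≈G = sumR-cong N (λ k k≤N → signed-cong (N ∸ k) (*-congˡ (F≈G k k≤N)))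

  finiteDiff-≈0 : ∀ N {G} → (∀ k → k ≤ N → G k ≈ 0#) → finiteDiff N G ≈ 0#
  finiteDiff-≈0 N G≈0 = sumR-≈0 N (λ k k≤N → signed-≈0 (N ∸ k) (≈0-*ʳ _ (G≈0 k k≤N)))

  finiteDiff-‿ : ∀ N F → finiteDiff N (λ k → - F k) ≈ - finiteDiff N F
  finiteDiff-‿ N F =
    trans (sumR-cong N (λ k _ → trans (signed-cong (N ∸ k) (sym (-‿distribʳ-* _ _))) (signed-‿ (N ∸ k) _)))
          (sumR-‿ N _)

  finiteDiff-+ : ∀ N F G → finiteDiff N (λ k → F k + G k) ≈ finiteDiff N F + finiteDiff N G
  finiteDiff-+ N F G =
    trans (sumR-cong N (λ k _ → trans (signed-cong (N ∸ k) (distribˡ _ _ _)) (signed-+ (N ∸ k) _ _)))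
          (sumR-+ N _ _)

  finiteDiff-- : ∀ N F G → finiteDiff N (λ k → F k - G k) ≈ finiteDiff N F - finiteDiff N G
  finiteDiff-- N F G = trans (finiteDiff-+ N F (λ k → - G k)) (+-congˡ (finiteDiff-‿ N G))

  finiteDiff-suc : ∀ N G → finiteDiff (suc N) G ≈ finiteDiff N (G ∘ suc) - finiteDiff N G
  finiteDiff-suc N G = begin
    finiteDiff (suc N) G
      ≈⟨ sumR-head N _ ⟩
    G₀ + sumR R N (λ k → signed (N ∸ k) (ι R (suc N C suc k) * G (suc k)))
      ≈⟨ +-congˡ (sumR-cong N (λ k _ → signed-pascal k)) ⟩
    G₀ + sumR R N (λ k → signed (N ∸ k) (ι R (N C k) * G (suc k)) + X k)
      ≈⟨ +-congˡ (sumR-+ N _ _) ⟩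
    G₀ + (finiteDiff N (G ∘ suc) + sumR R N X)
      ≈⟨ x+[y+z]≈y+[x+z] G₀ _ _ ⟩
    finiteDiff N (G ∘ suc) + (G₀ + sumR R N X)
      ≈⟨ +-congˡ -finiteDiff ⟨
    finiteDiff N (G ∘ suc) - finiteDiff N G ∎
    where
    G₀ : A
    G₀ = signed (suc N) (ι R (N C 0) * G 0)
    X Y : ℕ → A
    X k = signed (N ∸ k) (ι R (N C suc k) * G (suc k))
    Y k = signed (suc N ∸ k) (ι R (N C k) * G k)
    signed-pascal : ∀ k → signed (N ∸ k) (ι R (suc N C suc k) * G (suc k))
                          ≈ signed (N ∸ k) (ι R (N C k) * G (suc k)) + X k
    signed-pascal k = trans (signed-cong (N ∸ k) (trans (*-congʳ (trans (ι-≡ (Binomial.pascal N k)) (ι-+ (N C k) (N C suc k))))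
                                                        (distribʳ _ _ _)))
                            (signed-+ (N ∸ k) _ _)
    -finiteDiff : - finiteDiff N G ≈ G₀ + sumR R N X
    -finiteDiff = begin
      - finiteDiff N G
        ≈⟨ sumR-‿ N _ ⟨
      sumR R N (λ k → - signed (N ∸ k) (ι R (N C k) * G k))
        ≈⟨ sumR-cong N (λ k k≤N → reflexive (≡.cong (λ e → signed e (ι R (N C k) * G k))
                                                     (≡.sym (ℕ.+-∸-assoc 1 k≤N)))) ⟩
      sumR R N Y
        ≈⟨ +-identityʳ _ ⟨
      sumR R N Y + 0#
        ≈⟨ +-congˡ (signed-≈0 (N ∸ N) (≈0-*ˡ _ (ι-C-≈0 (ℕ.n<1+n N)))) ⟨
      sumR R (suc N) Y
        ≈⟨ sumR-head N Y ⟩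
      G₀ + sumR R N X ∎

  finiteDiff-degreeBelow : ∀ N G → DegreeBelow N G → finiteDiff N G ≈ 0#
  finiteDiff-degreeBelow zero    G G≈0 = ≈0-*ʳ _ (G≈0 0)
  finiteDiff-degreeBelow (suc N) G degG =
    trans (finiteDiff-suc N G) (trans (sym (finiteDiff-- N (G ∘ suc) G)) (finiteDiff-degreeBelow N (Δ G) degG))

  degreeBelow-ι : DegreeBelow 2 (ι R)
  degreeBelow-ι = degreeBelow-cong 1 (λ k → sym (//-rightDividesʳ (ι R k) 1#)) (degreeBelow-const 1#)

  degreeBelow-C : ∀ s → DegreeBelow (suc s) (λ k → ι R (k C s))
  degreeBelow-C zero    = degreeBelow-const (ι R 1)
  degreeBelow-C (suc s) = degreeBelow-cong (suc s) ΔC≈C (degreeBelow-C s)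
    where
    ΔC≈C : ∀ k → ι R (k C s) ≈ Δ (λ k → ι R (k C suc s)) k
    ΔC≈C k = begin
      ι R (k C s)                                        ≈⟨ +-identityʳ _ ⟨
      ι R (k C s) + 0#                                   ≈⟨ +-congˡ (-‿inverseʳ _) ⟨
      ι R (k C s) + (ι R (k C suc s) - ι R (k C suc s))  ≈⟨ +-assoc _ _ _ ⟨
      (ι R (k C s) + ι R (k C suc s)) - ι R (k C suc s)  ≈⟨ +-congʳ (ι-+ (k C s) (k C suc s)) ⟨
      ι R (k C s +ℕ k C suc s) - ι R (k C suc s)         ≈⟨ +-congʳ (ι-≡ (Binomial.pascal k s)) ⟨
      ι R (suc k C suc s) - ι R (k C suc s)              ∎

  degreeBelow-eval : ∀ d (f : Vec A d) → DegreeBelow d (λ k → eval R f (ι R k))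
  degreeBelow-eval zero          []      k = refl
  degreeBelow-eval (suc zero)    (a ∷ []) =
    degreeBelow-cong 1 (λ k → sym (trans (+-congˡ (zeroʳ _)) (+-identityʳ a))) (degreeBelow-const a)
  degreeBelow-eval (suc (suc d)) (a ∷ f) =
    degreeBelow-+ (suc (suc d)) _ _ (degreeBelow-≤ {1} {suc (suc d)} (s≤s z≤n) (degreeBelow-const a))
                  (degreeBelow-* 1 d (ι R) _ degreeBelow-ι (degreeBelow-eval (suc d) f))

  finiteDiff-C-diag : ∀ i → finiteDiff i (λ k → ι R (k C i)) ≈ 1#
  finiteDiff-C-diag i = begin
    finiteDiff i (λ k → ι R (k C i))
      ≈⟨ sumR-single i i ℕ.≤-refl (λ k k≤i k≢i →
           signed-≈0 (i ∸ k) (≈0-*ʳ _ (ι-C-≈0 (ℕ.≤∧≢⇒< k≤i k≢i)))) ⟩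
    signed (i ∸ i) (ι R (i C i) * ι R (i C i))
      ≈⟨ reflexive (≡.cong (λ e → signed e (ι R (i C i) * ι R (i C i))) (ℕ.n∸n≡0 i)) ⟩
    ι R (i C i) * ι R (i C i)
      ≈⟨ *-cong (ι-C-diag i) (ι-C-diag i) ⟩
    1# * 1#
      ≈⟨ *-identityˡ 1# ⟩
    1# ∎

  finiteDiff-C-< : ∀ {i j} → j < i → finiteDiff i (λ k → ι R (k C j)) ≈ 0#
  finiteDiff-C-< {i} {j} j<i = finiteDiff-degreeBelow i _ (degreeBelow-≤ j<i (degreeBelow-C j))

module Interpolation {c ℓ : Level} (R : CommutativeRing c ℓ) (ℚ⊆R : ContainsRationals R) where

  open RingLemmas R
  open import Relation.Binary.Reasoning.Setoid setoid
  open import Data.Vec using (map; zipWith; _∷ʳ_)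

  unit-ι : ∀ {n} → 0 < n → Unit (ι R n)
  unit-ι {suc n} _ = ℚ⊆R n

  unit-falling : ∀ {m k} → m ≤ k → Unit (falling R k m)
  unit-falling {zero}  _   = 1# , *-identityˡ 1#
  unit-falling {suc m} m<k = unit-* (unit-falling (ℕ.<⇒≤ m<k)) (unit-ι (ℕ.m<n⇒0<n∸m m<k))

  eval-∷ʳ0 : ∀ {d} (f : Vec A d) x → eval R (f ∷ʳ 0#) x ≈ eval R f x
  eval-∷ʳ0 []      x = trans (+-identityˡ _) (zeroʳ x)
  eval-∷ʳ0 (a ∷ f) x = +-congˡ (*-congˡ (eval-∷ʳ0 f x))

  eval-+ : ∀ {d} (f g : Vec A d) x → eval R (zipWith _+_ f g) x ≈ eval R f x + eval R g x
  eval-+ []      []      x = sym (+-identityʳ 0#)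
  eval-+ (a ∷ f) (b ∷ g) x = begin
    (a + b) + x * eval R (zipWith _+_ f g) x  ≈⟨ +-congˡ (*-congˡ (eval-+ f g x)) ⟩
    (a + b) + x * (eval R f x + eval R g x)   ≈⟨ +-congˡ (distribˡ x _ _) ⟩
    (a + b) + (x * eval R f x + x * eval R g x) ≈⟨ +-interchange a b _ _ ⟩
    (a + x * eval R f x) + (b + x * eval R g x) ∎

  eval-*ˡ : ∀ {d} a (f : Vec A d) x → eval R (map (a *_) f) x ≈ a * eval R f x
  eval-*ˡ a []      x = sym (zeroʳ a)
  eval-*ˡ a (b ∷ f) x = begin
    a * b + x * eval R (map (a *_) f) x  ≈⟨ +-congˡ (*-congˡ (eval-*ˡ a f x)) ⟩
    a * b + x * (a * eval R f x)         ≈⟨ +-congˡ (x*[y*z]≈y*[x*z] x a _) ⟩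
    a * b + a * (x * eval R f x)         ≈⟨ distribˡ a b _ ⟨
    a * (b + x * eval R f x)             ∎

  *linear : ∀ {d} → A → Vec A d → Vec A (suc d)
  *linear a f = zipWith _+_ (0# ∷ f) (map (a *_) f ∷ʳ 0#)

  eval-*linear : ∀ {d} a (f : Vec A d) x → eval R (*linear a f) x ≈ (x + a) * eval R f x
  eval-*linear a f x = begin
    eval R (*linear a f) x
      ≈⟨ eval-+ (0# ∷ f) (map (a *_) f ∷ʳ 0#) x ⟩
    (0# + x * eval R f x) + eval R (map (a *_) f ∷ʳ 0#) x
      ≈⟨ +-cong (+-identityˡ _) (trans (eval-∷ʳ0 (map (a *_) f) x) (eval-*ˡ a f x)) ⟩
    x * eval R f x + a * eval R f x
      ≈⟨ distribʳ _ x a ⟨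
    (x + a) * eval R f x ∎

  -- (X - lo) (X - lo - 1) ⋯ (X - lo - L + 1)
  newtonBasis : ℕ → (L : ℕ) → Vec A (suc L)
  newtonBasis lo zero    = 1# ∷ []
  newtonBasis lo (suc L) = *linear (- ι R (lo +ℕ L)) (newtonBasis lo L)

  ι-∸ : ∀ {m n} → m ≤ n → ι R (n ∸ m) ≈ ι R n - ι R m
  ι-∸ {m} {n} m≤n = begin
    ι R (n ∸ m)                    ≈⟨ //-rightDividesʳ (ι R m) _ ⟨
    (ι R (n ∸ m) + ι R m) - ι R m  ≈⟨ +-congʳ (ι-+ (n ∸ m) m) ⟨
    ι R (n ∸ m +ℕ m) - ι R m       ≈⟨ +-congʳ (ι-≡ (ℕ.m∸n+n≡m m≤n)) ⟩
    ι R n - ι R m                  ∎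

  newtonBasis-root : ∀ lo L k → lo ≤ k → k < lo +ℕ L → eval R (newtonBasis lo L) (ι R k) ≈ 0#
  newtonBasis-root lo zero    k lo≤k k<lo+0 = ⊥-elim (ℕ.<⇒≱ k<lo+0 (≡.subst (_≤ k) (≡.sym (ℕ.+-identityʳ lo)) lo≤k))
  newtonBasis-root lo (suc L) k lo≤k k<lo+1+L = trans (eval-*linear _ (newtonBasis lo L) (ι R k)) factor≈0
    where
    factor≈0 : (ι R k - ι R (lo +ℕ L)) * eval R (newtonBasis lo L) (ι R k) ≈ 0#
    factor≈0 with k ≟ lo +ℕ L
    ... | yes ≡.refl = ≈0-*ˡ _ (-‿inverseʳ _)
    ... | no  k≢lo+L = ≈0-*ʳ _ (newtonBasis-root lo L k lo≤k
                         (ℕ.≤∧≢⇒< (ℕ.≤-pred (≡.subst (suc k ≤_) (ℕ.+-suc lo L) k<lo+1+L)) k≢lo+L))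

  newtonBasis-unit : ∀ lo L k → lo +ℕ L ≤ k → Unit (eval R (newtonBasis lo L) (ι R k))
  newtonBasis-unit lo zero    k _ = unit-cong (sym (trans (+-congˡ (zeroʳ _)) (+-identityʳ 1#))) (1# , *-identityˡ 1#)
  newtonBasis-unit lo (suc L) k lo+1+L≤k =
    unit-cong (sym (eval-*linear _ (newtonBasis lo L) (ι R k)))
      (unit-* (unit-cong (ι-∸ (ℕ.<⇒≤ lo+L<k)) (unit-ι (ℕ.m<n⇒0<n∸m lo+L<k)))
              (newtonBasis-unit lo L k (ℕ.<⇒≤ lo+L<k)))
    where
    lo+L<k : lo +ℕ L < k
    lo+L<k = ≡.subst (_≤ k) (ℕ.+-suc lo L) lo+1+L≤k

  -- Newton's step: correct the interpolant on [lo, lo+L] at lo+L+1 by a multiple of the basis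
  -- polynomial vanishing on [lo, lo+L].
  interpolate : ∀ L lo (y : ℕ → A) →
                Σ (Vec A (suc L)) λ f → ∀ k → lo ≤ k → k ≤ lo +ℕ L → eval R f (ι R k) ≈ y k
  interpolate zero    lo y = y lo ∷ [] , fits
    where
    fits : ∀ k → lo ≤ k → k ≤ lo +ℕ 0 → eval R (y lo ∷ []) (ι R k) ≈ y k
    fits k lo≤k k≤lo+0 with ℕ.≤-antisym lo≤k (≡.subst (k ≤_) (ℕ.+-identityʳ lo) k≤lo+0)
    ... | ≡.refl = trans (+-congˡ (zeroʳ _)) (+-identityʳ _)
  interpolate (suc L) lo y = f , fits
    where
    f₀ : Vec A (suc L)
    f₀ = proj₁ (interpolate L lo y)
    top : ℕ
    top = lo +ℕ suc L
    b : A
    b = eval R (newtonBasis lo (suc L)) (ι R top)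
    u : Unit b
    u = newtonBasis-unit lo (suc L) top ℕ.≤-refl
    a : A
    a = proj₁ u * (y top - eval R f₀ (ι R top))
    f : Vec A (suc (suc L))
    f = zipWith _+_ (f₀ ∷ʳ 0#) (map (a *_) (newtonBasis lo (suc L)))
    eval-f : ∀ k → eval R f (ι R k) ≈ eval R f₀ (ι R k) + a * eval R (newtonBasis lo (suc L)) (ι R k)
    eval-f k = trans (eval-+ (f₀ ∷ʳ 0#) (map (a *_) (newtonBasis lo (suc L))) (ι R k))
                     (+-cong (eval-∷ʳ0 f₀ (ι R k)) (eval-*ˡ a (newtonBasis lo (suc L)) (ι R k)))
    fits : ∀ k → lo ≤ k → k ≤ top → eval R f (ι R k) ≈ y k
    fits k lo≤k k≤top with k ≟ top
    ... | yes ≡.refl = begin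
      eval R f (ι R top)                             ≈⟨ eval-f top ⟩
      eval R f₀ (ι R top) + a * b                    ≈⟨ +-congˡ (*-comm a b) ⟩
      eval R f₀ (ι R top) + b * a                    ≈⟨ +-congˡ (unit-*-inverse u _) ⟩
      eval R f₀ (ι R top) + (y top - eval R f₀ (ι R top)) ≈⟨ +-comm _ _ ⟩
      (y top - eval R f₀ (ι R top)) + eval R f₀ (ι R top) ≈⟨ //-rightDividesˡ _ (y top) ⟩
      y top                                          ∎
    ... | no k≢top = trans (eval-f k) (trans (+-cong (proj₂ (interpolate L lo y) k lo≤k k≤lo+L)
                                                     (≈0-*ʳ a (newtonBasis-root lo (suc L) k lo≤k k<top)))
                                             (+-identityʳ _))
      where
      k<top : k < top
      k<top = ℕ.≤∧≢⇒< k≤top k≢top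
      k≤lo+L : k ≤ lo +ℕ L
      k≤lo+L = ℕ.≤-pred (≡.subst (suc k ≤_) (ℕ.+-suc lo L) k<top)

module Coefficients {c ℓ : Level} (R : CommutativeRing c ℓ) where

  open RingLemmas R
  open import Relation.Binary.Reasoning.Setoid setoid

  infix 8 _·ξ^_

  _·ξ^_ : A → ℕ → Poly R
  (a ·ξ^ e) s with e ≟ s
  ... | yes _ = a
  ... | no  _ = 0#

  ·ξ^-≡ : ∀ a e → (a ·ξ^ e) e ≈ a
  ·ξ^-≡ a e with e ≟ e
  ... | yes _   = refl
  ... | no  e≢e = ⊥-elim (e≢e ≡.refl)

  ·ξ^-≢ : ∀ a e s → e ≢ s → (a ·ξ^ e) s ≈ 0#
  ·ξ^-≢ a e s e≢s with e ≟ s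
  ... | yes e≡s = ⊥-elim (e≢s e≡s)
  ... | no  _   = refl

  ·ξ^-suc : ∀ a e s → (a ·ξ^ suc e) (suc s) ≈ (a ·ξ^ e) s
  ·ξ^-suc a e s with e ≟ s
  ... | yes ≡.refl = ·ξ^-≡ a (suc e)
  ... | no  e≢s    = ·ξ^-≢ a (suc e) (suc s) (e≢s ∘ ℕ.suc-injective)

  ·ξ^-≈0 : ∀ {a} e s → a ≈ 0# → (a ·ξ^ e) s ≈ 0#
  ·ξ^-≈0 e s a≈0 with e ≟ s
  ... | yes _ = a≈0
  ... | no  _ = refl

  ·ξ^-cong : ∀ {a b} e s → a ≈ b → (a ·ξ^ e) s ≈ (b ·ξ^ e) s
  ·ξ^-cong e s a≈b with e ≟ s
  ... | yes _ = a≈b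
  ... | no  _ = refl

  ·ξ^-*ˡ : ∀ a b e s → a * (b ·ξ^ e) s ≈ ((a * b) ·ξ^ e) s
  ·ξ^-*ˡ a b e s with e ≟ s
  ... | yes _ = refl
  ... | no  _ = zeroʳ a

  sumP-coeff : ∀ n (F : ℕ → Poly R) t → sumP R n F t ≈ sumR R n (λ k → F k t)
  sumP-coeff zero    F t = refl
  sumP-coeff (suc n) F t = +-congʳ (sumP-coeff n F t)

  *P-congˡ : ∀ {f g} h t → (∀ s → f s ≈ g s) → (_*P_ R f h) t ≈ (_*P_ R g h) t
  *P-congˡ h t f≈g = sumR-cong t (λ i _ → *-congʳ (f≈g i))

  *P-congʳ : ∀ f {g h} t → (∀ s → g s ≈ h s) → (_*P_ R f g) t ≈ (_*P_ R f h) t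
  *P-congʳ f t g≈h = sumR-cong t (λ i _ → *-congˡ (g≈h (t ∸ i)))

  *P-≈0ˡ : ∀ f g t → (∀ s → f s ≈ 0#) → (_*P_ R f g) t ≈ 0#
  *P-≈0ˡ f g t f≈0 = sumR-≈0 t (λ i _ → ≈0-*ˡ _ (f≈0 i))

  *P-distribʳ-- : ∀ f g h t → (_*P_ R (λ s → f s - g s) h) t ≈ (_*P_ R f h) t - (_*P_ R g h) t
  *P-distribʳ-- f g h t = trans (sumR-cong t (λ i _ → [y-z]x≈yx-zx (h (t ∸ i)) (f i) (g i))) (sumR-- t _ _)

  *P-≈0ʳ : ∀ f g t → (∀ s → g s ≈ 0#) → (_*P_ R f g) t ≈ 0#
  *P-≈0ʳ f g t g≈0 = sumR-≈0 t (λ i _ → ≈0-*ʳ _ (g≈0 (t ∸ i)))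

  constP-*P : ∀ a f t → (_*P_ R (constP R a) f) t ≈ a * f t
  constP-*P a f t = sumR-single t 0 z≤n (λ { zero _ 0≢0 → ⊥-elim (0≢0 ≡.refl) ; (suc i) _ _ → zeroˡ _ })

  ·ξ^-*P : ∀ a e f {t} → e ≤ t → (_*P_ R (a ·ξ^ e) f) t ≈ a * f (t ∸ e)
  ·ξ^-*P a e f {t} e≤t =
    trans (sumR-single t e e≤t (λ i _ i≢e → ≈0-*ˡ _ (·ξ^-≢ a e i (i≢e ∘ ≡.sym))))
          (*-congʳ (·ξ^-≡ a e))

  ·ξ^-*P-< : ∀ a e f {t} → t < e → (_*P_ R (a ·ξ^ e) f) t ≈ 0#
  ·ξ^-*P-< a e f {t} t<e =
    sumR-≈0 t (λ i i≤t → ≈0-*ˡ _ (·ξ^-≢ a e i (λ e≡i → ℕ.<⇒≱ t<e (≡.subst (_≤ t) (≡.sym e≡i) i≤t))))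

  *P-·ξ^ : ∀ f a e {t} → e ≤ t → (_*P_ R f (a ·ξ^ e)) t ≈ f (t ∸ e) * a
  *P-·ξ^ f a e {t} e≤t = begin
    (_*P_ R f (a ·ξ^ e)) t
      ≈⟨ sumR-single t (t ∸ e) (ℕ.m∸n≤m t e)
                     (λ i i≤t i≢t∸e → ≈0-*ʳ _ (·ξ^-≢ a e (t ∸ i) (e≢t∸i i≤t i≢t∸e))) ⟩
    f (t ∸ e) * (a ·ξ^ e) (t ∸ (t ∸ e))
      ≈⟨ *-congˡ (reflexive (≡.cong (a ·ξ^ e) (ℕ.m∸[m∸n]≡n e≤t))) ⟩
    f (t ∸ e) * (a ·ξ^ e) e
      ≈⟨ *-congˡ (·ξ^-≡ a e) ⟩
    f (t ∸ e) * a ∎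
    where
    e≢t∸i : ∀ {i} → i ≤ t → i ≢ t ∸ e → e ≢ t ∸ i
    e≢t∸i {i} i≤t i≢t∸e e≡t∸i =
      i≢t∸e (≡.trans (≡.sym (ℕ.m∸[m∸n]≡n i≤t)) (≡.cong (t ∸_) (≡.sym e≡t∸i)))

  *P-·ξ^-< : ∀ f a e {t} → t < e → (_*P_ R f (a ·ξ^ e)) t ≈ 0#
  *P-·ξ^-< f a e {t} t<e =
    sumR-≈0 t (λ i _ → ≈0-*ʳ _ (·ξ^-≢ a e (t ∸ i)
                 (λ e≡t∸i → ℕ.<⇒≱ t<e (≡.subst (_≤ t) (≡.sym e≡t∸i) (ℕ.m∸n≤m t i)))))

  ξ^-coeff : ∀ e s → (_^P_ R (ξ R) e) s ≈ (1# ·ξ^ e) s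
  ξ^-coeff zero    zero    = sym (·ξ^-≡ 1# 0)
  ξ^-coeff zero    (suc s) = sym (·ξ^-≢ 1# 0 (suc s) (λ ()))
  ξ^-coeff (suc e) s = begin
    (_*P_ R (_^P_ R (ξ R) e) (ξ R)) s   ≈⟨ *P-congˡ (ξ R) s (ξ^-coeff e) ⟩
    (_*P_ R (1# ·ξ^ e) (ξ R)) s          ≈⟨ *P-congʳ (1# ·ξ^ e) s ξ≈1·ξ^1 ⟩
    (_*P_ R (1# ·ξ^ e) (1# ·ξ^ 1)) s     ≈⟨ shift s ⟩
    (1# ·ξ^ suc e) s                     ∎
    where
    ξ≈1·ξ^1 : ∀ s → ξ R s ≈ (1# ·ξ^ 1) s
    ξ≈1·ξ^1 zero          = sym (·ξ^-≢ 1# 1 0 (λ ()))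
    ξ≈1·ξ^1 (suc zero)    = sym (·ξ^-≡ 1# 1)
    ξ≈1·ξ^1 (suc (suc s)) = sym (·ξ^-≢ 1# 1 (suc (suc s)) (λ ()))
    shift : ∀ s → (_*P_ R (1# ·ξ^ e) (1# ·ξ^ 1)) s ≈ (1# ·ξ^ suc e) s
    shift zero    = trans (*P-·ξ^-< (1# ·ξ^ e) 1# 1 (s≤s z≤n)) (sym (·ξ^-≢ 1# (suc e) 0 (λ ())))
    shift (suc s) = trans (*P-·ξ^ (1# ·ξ^ e) 1# 1 (s≤s z≤n)) (trans (*-identityʳ _) (sym (·ξ^-suc 1# e s)))

  Bξ-coeff : ∀ l j s → Bξ R l j s ≈ (ι R (l C j) ·ξ^ (l ∸ j)) s
  Bξ-coeff l j s with j ≤? l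
  ... | yes _   = trans (constP-*P (ι R (l C j)) (_^P_ R (ξ R) (l ∸ j)) s)
                        (trans (*-congˡ (ξ^-coeff (l ∸ j) s))
                               (trans (·ξ^-*ˡ (ι R (l C j)) 1# (l ∸ j) s) (·ξ^-cong (l ∸ j) s (*-identityʳ _))))
  ... | no  j≰l = sym (·ξ^-≈0 (l ∸ j) s (ι-C-≈0 (ℕ.≰⇒> j≰l)))

  ·ξ^-+ : ∀ a d e {t} → d ≤ t → (a ·ξ^ e) (t ∸ d) ≈ (a ·ξ^ (d +ℕ e)) t
  ·ξ^-+ a d e {t} d≤t with e ≟ t ∸ d | d +ℕ e ≟ t
  ... | yes _     | yes _       = refl
  ... | no  _     | no  _       = refl
  ... | yes e≡t∸d | no  d+e≢t   = ⊥-elim (d+e≢t (≡.trans (≡.cong (d +ℕ_) e≡t∸d) (ℕ.m+[n∸m]≡n d≤t)))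
  ... | no  e≢t∸d | yes ≡.refl  = ⊥-elim (e≢t∸d (≡.sym (ℕ.m+n∸m≡n d e)))

  ·ξ^-*P-·ξ^ : ∀ a b d e t → (_*P_ R (a ·ξ^ d) (b ·ξ^ e)) t ≈ ((a * b) ·ξ^ (d +ℕ e)) t
  ·ξ^-*P-·ξ^ a b d e t with d ≤? t
  ... | yes d≤t = trans (·ξ^-*P a d (b ·ξ^ e) d≤t) (trans (·ξ^-*ˡ a b e (t ∸ d)) (·ξ^-+ (a * b) d e d≤t))
  ... | no  d≰t = trans (·ξ^-*P-< a d (b ·ξ^ e) (ℕ.≰⇒> d≰t))
                        (sym (·ξ^-≢ (a * b) (d +ℕ e) t (λ d+e≡t → d≰t (≡.subst (d ≤_) d+e≡t (ℕ.m≤m+n d e)))))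

  *P-Bξ-diag : ∀ f j t → (_*P_ R f (Bξ R j j)) t ≈ f t
  *P-Bξ-diag f j t = begin
    (_*P_ R f (Bξ R j j)) t                       ≈⟨ *P-congʳ f t (Bξ-coeff j j) ⟩
    (_*P_ R f (ι R (j C j) ·ξ^ (j ∸ j))) t        ≡⟨ ≡.cong (λ e → (_*P_ R f (ι R (j C j) ·ξ^ e)) t) (ℕ.n∸n≡0 j) ⟩
    (_*P_ R f (ι R (j C j) ·ξ^ 0)) t              ≈⟨ *P-·ξ^ f (ι R (j C j)) 0 z≤n ⟩
    f t * ι R (j C j)                             ≈⟨ *-congˡ (ι-C-diag j) ⟩
    f t * 1#                                      ≈⟨ *-identityʳ (f t) ⟩
    f t                                           ∎

  *P-Bξ-upper : ∀ f {k j} t → k < j → (_*P_ R f (Bξ R k j)) t ≈ 0#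
  *P-Bξ-upper f {k} {j} t k<j =
    *P-≈0ʳ f (Bξ R k j) t (λ s → trans (Bξ-coeff k j s) (·ξ^-≈0 (k ∸ j) s (ι-C-≈0 k<j)))

  Bξ-coeff-≢ : ∀ l j s → l ≢ j +ℕ s → (ι R (l C j) ·ξ^ (l ∸ j)) s ≈ 0#
  Bξ-coeff-≢ l j s l≢j+s with j ≤? l
  ... | yes j≤l =
    ·ξ^-≢ _ (l ∸ j) s (λ l∸j≡s → l≢j+s (≡.trans (≡.sym (ℕ.m+[n∸m]≡n j≤l)) (≡.cong (j +ℕ_) l∸j≡s)))
  ... | no  j≰l = ·ξ^-≈0 (l ∸ j) s (ι-C-≈0 (ℕ.≰⇒> j≰l))

  Bξ-coeff-≡ : ∀ j s → (ι R ((j +ℕ s) C j) ·ξ^ ((j +ℕ s) ∸ j)) s ≈ ι R ((j +ℕ s) C j)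
  Bξ-coeff-≡ j s = trans (reflexive (≡.cong (λ e → (ι R ((j +ℕ s) C j) ·ξ^ e) s) (ℕ.m+n∸m≡n j s)))
                         (·ξ^-≡ (ι R ((j +ℕ s) C j)) s)

  shift : ℕ → Poly R → Poly R
  shift d f t with d ≤? t
  ... | yes _ = f (t ∸ d)
  ... | no  _ = 0#

  shift-cong : ∀ d {f g} t → (∀ s → f s ≈ g s) → shift d f t ≈ shift d g t
  shift-cong d t f≈g with d ≤? t
  ... | yes _ = f≈g _
  ... | no  _ = refl

  ·ξ^-*P-shift : ∀ a d f t → (_*P_ R (a ·ξ^ d) f) t ≈ a * shift d f t
  ·ξ^-*P-shift a d f t with d ≤? t
  ... | yes d≤t = ·ξ^-*P a d f d≤t
  ... | no  d≰t = trans (·ξ^-*P-< a d f (ℕ.≰⇒> d≰t)) (sym (zeroʳ a))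

module InverseBinomial {c ℓ : Level} (R : CommutativeRing c ℓ) where

  open RingLemmas R
  open FiniteDifferences R
  open Coefficients R
  open NatArithmetic

  Bξ⁻¹ : Matrix R (Poly R)
  Bξ⁻¹ i k = signed (i ∸ k) (ι R (i C k)) ·ξ^ (i ∸ k)

  IdP-diag : ∀ i t → IdP R i i t ≈ constP R 1# t
  IdP-diag i t with i ≟ i
  ... | yes _   = refl
  ... | no  i≢i = ⊥-elim (i≢i ≡.refl)

  IdP-≢ : ∀ {i j} t → i ≢ j → IdP R i j t ≈ 0#
  IdP-≢ {i} {j} t i≢j with i ≟ j
  ... | yes i≡j = ⊥-elim (i≢j i≡j)
  ... | no  _   = refl

  private
    w : ℕ → ℕ → ℕ → A
    w i k j = signed (i ∸ k) (ι R (i C k) * ι R (k C j))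

    w≈0 : ∀ {i k j} → k < j → w i k j ≈ 0#
    w≈0 {i} {k} k<j = signed-≈0 (i ∸ k) (≈0-*ʳ _ (ι-C-≈0 k<j))

  Bξ⁻¹-*P-Bξ : ∀ i k j t → (_*P_ R (Bξ⁻¹ i k) (Bξ R k j)) t ≈ (w i k j ·ξ^ ((i ∸ k) +ℕ (k ∸ j))) t
  Bξ⁻¹-*P-Bξ i k j t =
    trans (*P-congʳ (Bξ⁻¹ i k) t (Bξ-coeff k j))
          (trans (·ξ^-*P-·ξ^ (signed (i ∸ k) (ι R (i C k))) (ι R (k C j)) (i ∸ k) (k ∸ j) t)
                 (·ξ^-cong ((i ∸ k) +ℕ (k ∸ j)) t (signed-*ʳ (i ∸ k) (ι R (i C k)) (ι R (k C j)))))

  Bξ⁻¹-leftInverse : ∀ i j t → sumR R i (λ k → (_*P_ R (Bξ⁻¹ i k) (Bξ R k j)) t) ≈ IdP R i j t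
  Bξ⁻¹-leftInverse i j t with j ≤? i | t ≟ i ∸ j
  ... | yes j≤i | yes ≡.refl =
    trans (sumR-cong i (λ k k≤i → trans (Bξ⁻¹-*P-Bξ i k j t) (at-i∸j k k≤i))) (finiteDiff-C (i ≟ j))
    where
    at-i∸j : ∀ k → k ≤ i → (w i k j ·ξ^ ((i ∸ k) +ℕ (k ∸ j))) (i ∸ j) ≈ w i k j
    at-i∸j k k≤i with j ≤? k
    ... | yes j≤k = trans (reflexive (≡.cong (λ e → (w i k j ·ξ^ e) (i ∸ j)) (m∸n+n∸o≡m∸o k≤i j≤k)))
                          (·ξ^-≡ (w i k j) (i ∸ j))
    ... | no  j≰k =
      trans (·ξ^-≈0 ((i ∸ k) +ℕ (k ∸ j)) (i ∸ j) (w≈0 {i} (ℕ.≰⇒> j≰k))) (sym (w≈0 {i} (ℕ.≰⇒> j≰k)))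
    finiteDiff-C : Dec (i ≡ j) → finiteDiff i (λ k → ι R (k C j)) ≈ IdP R i j (i ∸ j)
    finiteDiff-C (yes ≡.refl) = trans (finiteDiff-C-diag i)
                                      (sym (trans (IdP-diag i (i ∸ i)) (reflexive (≡.cong (constP R 1#) (ℕ.n∸n≡0 i)))))
    finiteDiff-C (no i≢j)     = trans (finiteDiff-C-< (ℕ.≤∧≢⇒< j≤i (i≢j ∘ ≡.sym))) (sym (IdP-≢ (i ∸ j) i≢j))
  ... | yes j≤i | no t≢i∸j =
    trans (sumR-≈0 i (λ k k≤i → trans (Bξ⁻¹-*P-Bξ i k j t) (off k k≤i))) (sym (IdP-off (i ≟ j) t t≢i∸j))
    where
    off : ∀ k → k ≤ i → (w i k j ·ξ^ ((i ∸ k) +ℕ (k ∸ j))) t ≈ 0#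
    off k k≤i with j ≤? k
    ... | yes j≤k = ·ξ^-≢ (w i k j) _ t (λ e≡t → t≢i∸j (≡.trans (≡.sym e≡t) (m∸n+n∸o≡m∸o k≤i j≤k)))
    ... | no  j≰k = ·ξ^-≈0 ((i ∸ k) +ℕ (k ∸ j)) t (w≈0 {i} (ℕ.≰⇒> j≰k))
    IdP-off : Dec (i ≡ j) → ∀ t → t ≢ i ∸ j → IdP R i j t ≈ 0#
    IdP-off (no i≢j)     t       _     = IdP-≢ t i≢j
    IdP-off (yes ≡.refl) zero    0≢i∸i = ⊥-elim (0≢i∸i (≡.sym (ℕ.n∸n≡0 i)))
    IdP-off (yes ≡.refl) (suc t) _     = IdP-diag i (suc t)
  ... | no j≰i | _ =
    trans (sumR-≈0 i (λ k k≤i → trans (Bξ⁻¹-*P-Bξ i k j t)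
                                      (·ξ^-≈0 ((i ∸ k) +ℕ (k ∸ j)) t (w≈0 {i} (ℕ.≤-<-trans k≤i (ℕ.≰⇒> j≰i))))))
          (sym (IdP-≢ t (λ i≡j → j≰i (ℕ.≤-reflexive (≡.sym i≡j)))))

  Bξ-cancelʳ : ∀ (f : ℕ → Poly R) i → (∀ j t → sumR R i (λ k → (_*P_ R (f k) (Bξ R k j)) t) ≈ 0#) →
               ∀ {j} → j ≤ i → ∀ t → f j t ≈ 0#
  Bξ-cancelʳ f i fB≈0 {j} j≤i = go (i ∸ j) ℕ.≤-refl j≤i
    where
    open import Relation.Binary.Reasoning.Setoid setoid
    -- back substitution along row i, using that B_ξ is unitriangular
    step : ∀ {j} → j ≤ i → (∀ {k} → j < k → k ≤ i → ∀ t → f k t ≈ 0#) → ∀ t → f j t ≈ 0#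
    step {j} j≤i later≈0 t = begin
      f j t                                          ≈⟨ *P-Bξ-diag (f j) j t ⟨
      (_*P_ R (f j) (Bξ R j j)) t                    ≈⟨ sumR-single i j j≤i (λ k k≤i k≢j → others k k≤i k≢j (j <? k)) ⟨
      sumR R i (λ k → (_*P_ R (f k) (Bξ R k j)) t)   ≈⟨ fB≈0 j t ⟩
      0#                                             ∎
      where
      others : ∀ k → k ≤ i → k ≢ j → Dec (j < k) → (_*P_ R (f k) (Bξ R k j)) t ≈ 0#
      others k k≤i k≢j (no  j≮k) = *P-Bξ-upper (f k) t (ℕ.≤∧≢⇒< (ℕ.≮⇒≥ j≮k) k≢j)
      others k k≤i k≢j (yes j<k) = *P-≈0ˡ (f k) (Bξ R k j) t (later≈0 j<k k≤i)
    go : ∀ d {j} → i ∸ j ≤ d → j ≤ i → ∀ t → f j t ≈ 0#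
    go zero    i∸j≤0   j≤i =
      step j≤i (λ j<k k≤i → ⊥-elim (ℕ.<⇒≱ (ℕ.∸-monoʳ-< j<k k≤i) (ℕ.≤-trans i∸j≤0 z≤n)))
    go (suc d) i∸j≤1+d j≤i =
      step j≤i (λ j<k k≤i → go d (ℕ.≤-pred (ℕ.≤-trans (ℕ.∸-monoʳ-< j<k k≤i) i∸j≤1+d)) k≤i)

  Bξ-leftInverse-unique : (Binv : Matrix R (Poly R)) → LowerTriangular R Binv →
                          (∀ i j → _≈P_ R ((_⋆ᴸ_ R Binv (Bξ R)) i j) (IdP R i j)) →
                          ∀ i k s → Binv i k s ≈ Bξ⁻¹ i k s
  Bξ-leftInverse-unique Binv lower leftInverse i k s with k ≤? i
  ... | yes k≤i = x∙y⁻¹≈ε⇒x≈y _ _ (Bξ-cancelʳ (λ k s → Binv i k s - Bξ⁻¹ i k s) i difference≈0 k≤i s)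
    where
    difference≈0 : ∀ j t → sumR R i (λ k → (_*P_ R (λ s → Binv i k s - Bξ⁻¹ i k s) (Bξ R k j)) t) ≈ 0#
    difference≈0 j t =
      trans (sumR-cong i (λ k _ → *P-distribʳ-- (Binv i k) (Bξ⁻¹ i k) (Bξ R k j) t))
            (trans (sumR-- i _ _)
                   (trans (+-cong (trans (sym (sumP-coeff i _ t)) (leftInverse i j t))
                                  (-‿cong (Bξ⁻¹-leftInverse i j t)))
                          (-‿inverseʳ _)))
  ... | no  k≰i = trans (lower i k (ℕ.≰⇒> k≰i) s)
                        (sym (·ξ^-≈0 (i ∸ k) s (signed-≈0 (i ∸ k) (ι-C-≈0 (ℕ.≰⇒> k≰i)))))

module DiagonalRecurrences {c ℓ : Level} (R : CommutativeRing c ℓ) where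

  open RingLemmas R
  open FiniteDifferences R
  open NatArithmetic
  open import Relation.Binary.Reasoning.Setoid setoid
  open import Data.Nat.Induction using (<-rec)

  finiteDiff-top : ∀ N G → (∀ k → k < N → G k ≈ 0#) → finiteDiff N G ≈ G N
  finiteDiff-top N G lower≈0 = begin
    finiteDiff N G
      ≈⟨ sumR-single N N ℕ.≤-refl (λ k k≤N k≢N →
           signed-≈0 (N ∸ k) (≈0-*ʳ _ (lower≈0 k (ℕ.≤∧≢⇒< k≤N k≢N)))) ⟩
    signed (N ∸ N) (ι R (N C N) * G N)
      ≡⟨ ≡.cong (λ e → signed e (ι R (N C N) * G N)) (ℕ.n∸n≡0 N) ⟩
    ι R (N C N) * G N
      ≈⟨ *-congʳ (ι-C-diag N) ⟩
    1# * G N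
      ≈⟨ *-identityˡ (G N) ⟩
    G N ∎

  -- Row n + r + 1 of the recurrences determines the value at k = n + r + 1 from the earlier ones,
  -- so two solutions agreeing on [lo, r] agree from lo on.
  recurrence-solutions-agree : ∀ r lo (a : ℕ → ℕ → A) (q g : ℕ → A) →
    (∀ n → finiteDiff (n +ℕ r +ℕ 1) (λ k → a n k * q k) ≈ 0#) →
    (∀ n → finiteDiff (n +ℕ r +ℕ 1) (λ k → a n k * g k) ≈ 0#) →
    (∀ n k → k < lo → a n k ≈ 0#) →
    (∀ n → Unit (a n (n +ℕ r +ℕ 1))) →
    (∀ k → lo ≤ k → k ≤ r → q k ≈ g k) →
    ∀ k → lo ≤ k → q k ≈ g k
  recurrence-solutions-agree r lo a q g q-solves g-solves a≈0 top-unit initial =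
    <-rec (λ k → lo ≤ k → q k ≈ g k) step
    where
    e : ℕ → A
    e k = q k - g k
    e-solves : ∀ n → finiteDiff (n +ℕ r +ℕ 1) (λ k → a n k * e k) ≈ 0#
    e-solves n = begin
      finiteDiff (n +ℕ r +ℕ 1) (λ k → a n k * e k)
        ≈⟨ finiteDiff-cong (n +ℕ r +ℕ 1) (λ k _ → x[y-z]≈xy-xz (a n k) (q k) (g k)) ⟩
      finiteDiff (n +ℕ r +ℕ 1) (λ k → a n k * q k - a n k * g k)
        ≈⟨ finiteDiff-- (n +ℕ r +ℕ 1) _ _ ⟩
      finiteDiff (n +ℕ r +ℕ 1) (λ k → a n k * q k) - finiteDiff (n +ℕ r +ℕ 1) (λ k → a n k * g k)
        ≈⟨ +-cong (q-solves n) (-‿cong (g-solves n)) ⟩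
      0# - 0#
        ≈⟨ -‿inverseʳ 0# ⟩
      0# ∎
    step : ∀ k → (∀ {k′} → k′ < k → lo ≤ k′ → q k′ ≈ g k′) → lo ≤ k → q k ≈ g k
    step k earlier lo≤k with k ≤? r
    ... | yes k≤r = initial k lo≤k k≤r
    ... | no  k≰r = x∙y⁻¹≈ε⇒x≈y (q k) (g k) (unit-cancel top-unit′ (begin
      a n k * e k                             ≈⟨ finiteDiff-top k _ earlier-terms ⟨
      finiteDiff k (λ k′ → a n k′ * e k′)     ≡⟨ ≡.cong (λ N → finiteDiff N (λ k′ → a n k′ * e k′)) n+r+1≡k ⟨
      finiteDiff (n +ℕ r +ℕ 1) (λ k′ → a n k′ * e k′) ≈⟨ e-solves n ⟩
      0#                                      ∎))
      where
      n : ℕ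
      n = k ∸ suc r
      n+r+1≡k : n +ℕ r +ℕ 1 ≡ k
      n+r+1≡k = m∸[1+n]+n+1≡m (ℕ.≰⇒> k≰r)
      top-unit′ : Unit (a n k)
      top-unit′ = ≡.subst (λ N → Unit (a n N)) n+r+1≡k (top-unit n)
      earlier-terms : ∀ k′ → k′ < k → a n k′ * e k′ ≈ 0#
      earlier-terms k′ k′<k with k′ <? lo
      ... | yes k′<lo = ≈0-*ˡ _ (a≈0 n k′ k′<lo)
      ... | no  k′≮lo = ≈0-*ʳ _ (x≈y⇒x∙y⁻¹≈ε (earlier k′<k (ℕ.≮⇒≥ k′≮lo)))

  ι-falling : ∀ k m → ι R (k P′ m) ≈ falling R k m
  ι-falling k zero    = ι-1
  ι-falling k (suc m) = trans (ι-* (k ∸ m) (k P′ m)) (trans (*-comm _ _) (*-congʳ (ι-falling k m)))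

  -- C(k-m, j) for k ≥ j + m and 0 otherwise; the guard matters only for k < m, where ∸ truncates.
  subdiagonalWeight : ℕ → ℕ → ℕ → A
  subdiagonalWeight m j k with j +ℕ m ≤? k
  ... | yes _ = ι R ((k ∸ m) C j)
  ... | no  _ = 0#

  subdiagonalWeight-≤ : ∀ m j {k} → j +ℕ m ≤ k → subdiagonalWeight m j k ≈ ι R ((k ∸ m) C j)
  subdiagonalWeight-≤ m j {k} j+m≤k with j +ℕ m ≤? k
  ... | yes _     = refl
  ... | no  j+m≰k = ⊥-elim (j+m≰k j+m≤k)

  subdiagonalWeight-< : ∀ m j {k} → k < j +ℕ m → subdiagonalWeight m j k ≈ 0#
  subdiagonalWeight-< m j {k} k<j+m with j +ℕ m ≤? k
  ... | yes j+m≤k = ⊥-elim (ℕ.<⇒≱ k<j+m j+m≤k)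
  ... | no  _     = refl

  superdiagonal-polynomial : ∀ {d} (f : Vec A (suc d)) {j N} → j +ℕ d < N →
                             finiteDiff N (λ k → ι R (suc k C j) * eval R f (ι R k)) ≈ 0#
  superdiagonal-polynomial {d} f {j} {N} j+d<N =
    finiteDiff-degreeBelow N _ (degreeBelow-≤ j+d<N
      (degreeBelow-* j d _ _ (degreeBelow-shift (suc j) _ (degreeBelow-C j)) (degreeBelow-eval (suc d) f)))

  -- C(k-m, j) m! C(k, m) = C(k, j+m) m! C(j+m, m) turns the weight into a polynomial in k.
  subdiagonal-polynomial : ∀ {d} m (f : Vec A (suc d)) {j N} → j +ℕ m +ℕ d < N →
    finiteDiff N (λ k → subdiagonalWeight m j k * (falling R k m * eval R f (ι R k))) ≈ 0#
  subdiagonal-polynomial {d} m f {j} {N} j+m+d<N =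
    finiteDiff-degreeBelow N _ (degreeBelow-≤ j+m+d<N
      (degreeBelow-cong (suc (j +ℕ m +ℕ d)) (λ k → sym (weight≈ k (j +ℕ m ≤? k)))
      (degreeBelow-* (j +ℕ m) d _ _ (degreeBelow-C (j +ℕ m))
                     (degreeBelow-*ˡ (suc d) _ _ (degreeBelow-eval (suc d) f)))))
    where
    weight≈ : ∀ k → Dec (j +ℕ m ≤ k) → subdiagonalWeight m j k * (falling R k m * eval R f (ι R k))
                                          ≈ ι R (k C (j +ℕ m)) * (ι R ((j +ℕ m) P′ m) * eval R f (ι R k))
    weight≈ k (yes j+m≤k) = begin
      subdiagonalWeight m j k * (falling R k m * eval R f (ι R k))
        ≈⟨ *-cong (subdiagonalWeight-≤ m j j+m≤k) (*-congʳ (sym (ι-falling k m))) ⟩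
      ι R ((k ∸ m) C j) * (ι R (k P′ m) * eval R f (ι R k))
        ≈⟨ *-assoc _ _ _ ⟨
      (ι R ((k ∸ m) C j) * ι R (k P′ m)) * eval R f (ι R k)
        ≈⟨ *-congʳ (ι-* ((k ∸ m) C j) (k P′ m)) ⟨
      ι R (((k ∸ m) C j) *ℕ (k P′ m)) * eval R f (ι R k)
        ≡⟨ ≡.cong (λ x → ι R x * eval R f (ι R k)) (Binomial.C-fallingFactorial m j k) ⟩
      ι R ((k C (j +ℕ m)) *ℕ ((j +ℕ m) P′ m)) * eval R f (ι R k)
        ≈⟨ *-congʳ (ι-* (k C (j +ℕ m)) ((j +ℕ m) P′ m)) ⟩
      (ι R (k C (j +ℕ m)) * ι R ((j +ℕ m) P′ m)) * eval R f (ι R k)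
        ≈⟨ *-assoc _ _ _ ⟩
      ι R (k C (j +ℕ m)) * (ι R ((j +ℕ m) P′ m) * eval R f (ι R k)) ∎
    weight≈ k (no  j+m≰k) =
      trans (≈0-*ˡ _ (subdiagonalWeight-< m j (ℕ.≰⇒> j+m≰k))) (sym (≈0-*ˡ _ (ι-C-≈0 (ℕ.≰⇒> j+m≰k))))

module Conjugation {c ℓ : Level} (R : CommutativeRing c ℓ)
  (r : ℕ) (P : Matrix R (CommutativeRing.Carrier R)) (banded : Banded R (IsZeroR R) r 1 P)
  (Binv : Matrix R (Poly R)) (lower : LowerTriangular R Binv)
  (leftInverse : ∀ i j → _≈P_ R ((_⋆ᴸ_ R Binv (Bξ R)) i j) (IdP R i j)) where

  open RingLemmas R
  open FiniteDifferences R
  open Coefficients R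
  open InverseBinomial R
  open DiagonalRecurrences R using (subdiagonalWeight; subdiagonalWeight-≤; subdiagonalWeight-<)
  open NatArithmetic
  open import Relation.Binary.Reasoning.Setoid setoid

  PBξ : ℕ → ℕ → Poly R
  PBξ k j s = P k (j +ℕ s) * ι R ((j +ℕ s) C j)

  PBξ-coeff : ∀ k j s → (_⋆ᵁ_ R P (Bξ R)) k j s ≈ PBξ k j s
  PBξ-coeff k j s = begin
    (_⋆ᵁ_ R P (Bξ R)) k j s
      ≈⟨ sumP-coeff (suc k) _ s ⟩
    sumR R (suc k) (λ l → (_*P_ R (constP R (P k l)) (Bξ R l j)) s)
      ≈⟨ sumR-cong (suc k) (λ l _ → trans (constP-*P (P k l) (Bξ R l j) s) (*-congˡ (Bξ-coeff l j s))) ⟩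
    sumR R (suc k) (λ l → P k l * (ι R (l C j) ·ξ^ (l ∸ j)) s)
      ≈⟨ only-j+s (j +ℕ s ≤? suc k) ⟩
    PBξ k j s ∎
    where
    only-j+s : Dec (j +ℕ s ≤ suc k) → sumR R (suc k) (λ l → P k l * (ι R (l C j) ·ξ^ (l ∸ j)) s) ≈ PBξ k j s
    only-j+s (yes j+s≤1+k) =
      trans (sumR-single (suc k) (j +ℕ s) j+s≤1+k (λ l _ l≢j+s → ≈0-*ʳ _ (Bξ-coeff-≢ l j s l≢j+s)))
            (*-congˡ (Bξ-coeff-≡ j s))
    only-j+s (no  j+s≰1+k) =
      trans (sumR-≈0 (suc k) (λ l l≤1+k → ≈0-*ʳ _ (Bξ-coeff-≢ l j s
                                 (λ l≡j+s → j+s≰1+k (≡.subst (_≤ suc k) l≡j+s l≤1+k)))))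
            (sym (≈0-*ˡ _ (banded k (j +ℕ s) (inj₂ (≡.subst (_< j +ℕ s) (ℕ.+-comm 1 k) (ℕ.≰⇒> j+s≰1+k))))))

  conjTerm : ℕ → ℕ → ℕ → ℕ → A
  conjTerm i j t k = shift (i ∸ k) (PBξ k j) t

  conj-coeff : ∀ i j t → conj R Binv P i j t ≈ finiteDiff i (conjTerm i j t)
  conj-coeff i j t = trans (sumP-coeff i _ t) (sumR-cong i (λ k _ → term k))
    where
    term : ∀ k → (_*P_ R (Binv i k) ((_⋆ᵁ_ R P (Bξ R)) k j)) t ≈ signed (i ∸ k) (ι R (i C k) * conjTerm i j t k)
    term k = begin
      (_*P_ R (Binv i k) ((_⋆ᵁ_ R P (Bξ R)) k j)) t
        ≈⟨ *P-congˡ ((_⋆ᵁ_ R P (Bξ R)) k j) t (Bξ-leftInverse-unique Binv lower leftInverse i k) ⟩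
      (_*P_ R (Bξ⁻¹ i k) ((_⋆ᵁ_ R P (Bξ R)) k j)) t
        ≈⟨ ·ξ^-*P-shift (signed (i ∸ k) (ι R (i C k))) (i ∸ k) ((_⋆ᵁ_ R P (Bξ R)) k j) t ⟩
      signed (i ∸ k) (ι R (i C k)) * shift (i ∸ k) ((_⋆ᵁ_ R P (Bξ R)) k j) t
        ≈⟨ *-congˡ (shift-cong (i ∸ k) t (PBξ-coeff k j)) ⟩
      signed (i ∸ k) (ι R (i C k)) * conjTerm i j t k
        ≈⟨ signed-*ʳ (i ∸ k) (ι R (i C k)) (conjTerm i j t k) ⟩
      signed (i ∸ k) (ι R (i C k) * conjTerm i j t k) ∎

  conjTerm-cases : ∀ {i j t k} → k ≤ i →
    (Σ ℕ λ l → j ≤ l × l +ℕ i ≡ k +ℕ (j +ℕ t) × conjTerm i j t k ≈ P k l * ι R (l C j))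
    ⊎ (k +ℕ (j +ℕ t) < i +ℕ j × conjTerm i j t k ≈ 0#)
  conjTerm-cases {i} {j} {t} {k} k≤i with i ∸ k ≤? t
  ... | yes i∸k≤t = inj₁ (j +ℕ (t ∸ (i ∸ k)) , ℕ.m≤m+n j _ , column-index j k≤i i∸k≤t , refl)
  ... | no  i∸k≰t = inj₂ (below-column-index j k≤i (ℕ.≰⇒> i∸k≰t) , refl)

  conjTerm-superdiagonal : ∀ {i j t k} → j +ℕ t ≡ suc i → k ≤ i → conjTerm i j t k ≈ ι R (suc k C j) * P k (suc k)
  conjTerm-superdiagonal {i} {j} {t} {k} j+t≡1+i k≤i with conjTerm-cases {i} {j} {t} k≤i
  ... | inj₁ (l , _ , l+i≡k+c , term≈) =
    trans term≈ (trans (reflexive (≡.cong (λ l → P k l * ι R (l C j)) (superdiagonal-column {i} {k} {l} j+t≡1+i l+i≡k+c)))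
                       (*-comm _ _))
  ... | inj₂ (k+c<i+j , term≈0) = trans term≈0 (sym (≈0-*ˡ _ (ι-C-≈0 (superdiagonal-below {i} {j} {k} j+t≡1+i k+c<i+j))))

  conjTerm-subdiagonal : ∀ {i j t k} m → i ≡ m +ℕ (j +ℕ t) → k ≤ i →
                         conjTerm i j t k ≈ subdiagonalWeight m j k * P k (k ∸ m)
  conjTerm-subdiagonal {i} {j} {t} {k} m i≡m+c k≤i with conjTerm-cases {i} {j} {t} k≤i
  ... | inj₁ (l , j≤l , l+i≡k+c , term≈) = begin
    conjTerm i j t k                  ≈⟨ term≈ ⟩
    P k l * ι R (l C j)               ≡⟨ ≡.cong (λ l → P k l * ι R (l C j)) l≡k∸m ⟩
    P k (k ∸ m) * ι R ((k ∸ m) C j)   ≈⟨ *-comm _ _ ⟩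
    ι R ((k ∸ m) C j) * P k (k ∸ m)   ≈⟨ *-congʳ (subdiagonalWeight-≤ m j j+m≤k) ⟨
    subdiagonalWeight m j k * P k (k ∸ m) ∎
    where
    l+m≡k : l +ℕ m ≡ k
    l+m≡k = subdiagonal-column {i} {k} {l} {m} i≡m+c l+i≡k+c
    l≡k∸m : l ≡ k ∸ m
    l≡k∸m = ≡.trans (≡.sym (ℕ.m+n∸n≡m l m)) (≡.cong (_∸ m) l+m≡k)
    j+m≤k : j +ℕ m ≤ k
    j+m≤k = ℕ.≤-trans (ℕ.+-monoˡ-≤ m j≤l) (ℕ.≤-reflexive l+m≡k)
  ... | inj₂ (k+c<i+j , term≈0) =
    trans term≈0 (sym (≈0-*ˡ _ (subdiagonalWeight-< m j (subdiagonal-below {i} {j} {k} {m} i≡m+c k+c<i+j))))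

  conjTerm-beyondBand : ∀ {i j t k} → suc (suc i) ≤ j +ℕ t → k ≤ i → conjTerm i j t k ≈ 0#
  conjTerm-beyondBand {i} {j} {t} {k} 2+i≤c k≤i with conjTerm-cases {i} {j} {t} k≤i
  ... | inj₁ (l , _ , l+i≡k+c , term≈) =
    trans term≈ (≈0-*ˡ _ (banded k l (inj₂ (beyondBand-column {i} {k} {l} 2+i≤c l+i≡k+c))))
  ... | inj₂ (_ , term≈0) = term≈0

  conjTerm-belowBand : ∀ {i j t k} m → r < m → i ≡ m +ℕ (j +ℕ t) → k ≤ i → conjTerm i j t k ≈ 0#
  conjTerm-belowBand {i} {j} {t} {k} m r<m i≡m+c k≤i with conjTerm-cases {i} {j} {t} k≤i
  ... | inj₁ (l , _ , l+i≡k+c , term≈) =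
    trans term≈ (≈0-*ˡ _ (banded k l (inj₁ (≡.subst (l +ℕ r <_) (subdiagonal-column {i} {k} {l} {m} i≡m+c l+i≡k+c)
                                                    (ℕ.+-monoʳ-< l r<m)))))
  ... | inj₂ (_ , term≈0) = term≈0

module Conditions {c ℓ : Level} (R : CommutativeRing c ℓ) (ℚ⊆R : ContainsRationals R)
  (r : ℕ) (P : Matrix R (CommutativeRing.Carrier R)) (banded : Banded R (IsZeroR R) r 1 P)
  (Binv : Matrix R (Poly R)) (lower : LowerTriangular R Binv)
  (leftInverse : ∀ i j → _≈P_ R ((_⋆ᴸ_ R Binv (Bξ R)) i j) (IdP R i j)) where

  open RingLemmas R
  open FiniteDifferences R
  open Interpolation R ℚ⊆R
  open DiagonalRecurrences R
  open Conjugation R r P banded Binv lower leftInverse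
  open NatArithmetic
  open import Relation.Binary.Definitions using (tri<; tri≈; tri>)

  subdiagonal-agrees : ∀ m (f : Vec A (suc (r ∸ m))) →
    (∀ n → m ≤ n → P n (n ∸ m) ≈ falling R n m * eval R f (ι R n)) →
    ∀ j k → subdiagonalWeight m j k * P k (k ∸ m) ≈ subdiagonalWeight m j k * (falling R k m * eval R f (ι R k))
  subdiagonal-agrees m f Pₘ≈f j k with m ≤? k
  ... | yes m≤k = *-congˡ (Pₘ≈f k m≤k)
  ... | no  m≰k = trans (≈0-*ˡ _ w≈0) (sym (≈0-*ˡ _ w≈0))
    where
    w≈0 : subdiagonalWeight m j k ≈ 0#
    w≈0 = subdiagonalWeight-< m j (ℕ.<-≤-trans (ℕ.≰⇒> m≰k) (ℕ.m≤n+m m j))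

  C⇒A : CondC R r P → CondA R r Binv P
  C⇒A ((f₋₁ , P₋₁≈f₋₁) , fits) i j outside t = trans (conj-coeff i j t) (vanishes outside)
    where
    beyondBand : suc (suc i) ≤ j +ℕ t → finiteDiff i (conjTerm i j t) ≈ 0#
    beyondBand 2+i≤c = finiteDiff-≈0 i (λ k k≤i → conjTerm-beyondBand 2+i≤c k≤i)
    subdiagonal : ∀ m → i ≡ m +ℕ (j +ℕ t) → j +ℕ r < i → Dec (m ≤ r) → finiteDiff i (conjTerm i j t) ≈ 0#
    subdiagonal m i≡m+c j+r<i (yes m≤r) =
      trans (finiteDiff-cong i (λ k k≤i → trans (conjTerm-subdiagonal m i≡m+c k≤i) (subdiagonal-agrees m fₘ Pₘ≈fₘ j k)))
            (subdiagonal-polynomial m fₘ (≡.subst (_< i) (≡.sym (j+m+[r∸m]≡j+r j m≤r)) j+r<i))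
      where
      fₘ : Vec A (suc (r ∸ m))
      fₘ = proj₁ (fits m m≤r)
      Pₘ≈fₘ : ∀ n → m ≤ n → P n (n ∸ m) ≈ falling R n m * eval R fₘ (ι R n)
      Pₘ≈fₘ = proj₂ (fits m m≤r)
    subdiagonal m i≡m+c _ (no m≰r) = finiteDiff-≈0 i (λ k k≤i → conjTerm-belowBand m (ℕ.≰⇒> m≰r) i≡m+c k≤i)
    vanishes : j +ℕ r < i ⊎ i +ℕ 1 < j → finiteDiff i (conjTerm i j t) ≈ 0#
    vanishes (inj₂ i+1<j) = beyondBand (ℕ.≤-trans (≡.subst (_< j) (ℕ.+-comm i 1) i+1<j) (ℕ.m≤m+n j t))
    vanishes (inj₁ j+r<i) with ℕ.<-cmp (j +ℕ t) (suc i)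
    ... | tri> _ _ 1+i<c = beyondBand 1+i<c
    ... | tri≈ _ c≡1+i _ =
      trans (finiteDiff-cong i (λ k k≤i → trans (conjTerm-superdiagonal c≡1+i k≤i) (*-congˡ (P₋₁≈f₋₁ k))))
            (superdiagonal-polynomial f₋₁ j+r<i)
    ... | tri< c<1+i _ _ =
      subdiagonal (i ∸ (j +ℕ t)) (≡.sym (ℕ.m∸n+n≡m (ℕ.≤-pred c<1+i))) j+r<i (i ∸ (j +ℕ t) ≤? r)

  A⇒B : CondA R r Binv P → CondB R r Binv P
  A⇒B condA n = condA (n +ℕ r +ℕ 1) n (inj₁ (≡.subst (n +ℕ r <_) (ℕ.+-comm 1 (n +ℕ r)) (ℕ.n<1+n (n +ℕ r))))

  module _ (condB : CondB R r Binv P) where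

    condB-row : ∀ n t → finiteDiff (n +ℕ r +ℕ 1) (conjTerm (n +ℕ r +ℕ 1) n t) ≈ 0#
    condB-row n t = trans (sym (conj-coeff (n +ℕ r +ℕ 1) n t)) (condB n t)

    B⇒superdiagonal : Σ (Vec A (suc r)) λ f → ∀ n → P n (suc n) ≈ eval R f (ι R n)
    B⇒superdiagonal = f , λ n →
      recurrence-solutions-agree r 0 (λ n k → ι R (suc k C n)) (λ k → P k (suc k)) (λ k → eval R f (ι R k))
        (λ n → trans (sym (finiteDiff-cong (n +ℕ r +ℕ 1)
                             (λ k k≤ → conjTerm-superdiagonal (n+[r+2]≡1+[n+r+1] n r) k≤)))
                     (condB-row n (suc (suc r))))
        (λ n → superdiagonal-polynomial f (ℕ.≤-reflexive (≡.sym (n+r+1≡1+[n+r] n r))))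
        (λ n k ())
        (λ n → unit-ι (Binomial.C-pos (ℕ.m≤n⇒m≤1+n (ℕ.≤-trans (ℕ.m≤m+n n r) (ℕ.m≤m+n (n +ℕ r) 1)))))
        (λ k _ k≤r → sym (proj₂ (interpolate r 0 (λ k → P k (suc k))) k z≤n k≤r))
        n z≤n
      where
      f : Vec A (suc r)
      f = proj₁ (interpolate r 0 (λ k → P k (suc k)))

    B⇒subdiagonal : ∀ m → m ≤ r →
      Σ (Vec A (suc (r ∸ m))) λ f → ∀ n → m ≤ n → P n (n ∸ m) ≈ falling R n m * eval R f (ι R n)
    B⇒subdiagonal m m≤r = f ,
      recurrence-solutions-agree r m (subdiagonalWeight m) (λ k → P k (k ∸ m)) g
        (λ n → trans (sym (finiteDiff-cong (n +ℕ r +ℕ 1)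
                             (λ k k≤ → conjTerm-subdiagonal m (n+r+1≡m+[n+1+[r∸m]] n m≤r) k≤)))
                     (condB-row n (suc (r ∸ m))))
        (λ n → subdiagonal-polynomial m f (≡.subst (_< n +ℕ r +ℕ 1) (≡.sym (j+m+[r∸m]≡j+r n m≤r))
                                                   (ℕ.≤-reflexive (≡.sym (n+r+1≡1+[n+r] n r)))))
        (λ n k k<m → subdiagonalWeight-< m n (ℕ.<-≤-trans k<m (ℕ.m≤n+m m n)))
        (λ n → unit-cong (sym (subdiagonalWeight-≤ m n (n+m≤n+r+1 n m≤r)))
                         (unit-ι (Binomial.C-pos (n≤n+r+1∸m n m≤r))))
        (λ k m≤k k≤r → sym (trans (*-congˡ (proj₂ (interpolate (r ∸ m) m y) k m≤k (k≤m+[r∸m] k≤r))) (y-spec m≤k)))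
      where
      y : ℕ → A
      y k with m ≤? k
      ... | yes m≤k = proj₁ (unit-falling m≤k) * P k (k ∸ m)
      ... | no  _   = 0#
      y-spec : ∀ {k} → m ≤ k → falling R k m * y k ≈ P k (k ∸ m)
      y-spec {k} m≤k with m ≤? k
      ... | yes m≤k′ = unit-*-inverse (unit-falling m≤k′) _
      ... | no  m≰k  = ⊥-elim (m≰k m≤k)
      k≤m+[r∸m] : ∀ {k} → k ≤ r → k ≤ m +ℕ (r ∸ m)
      k≤m+[r∸m] {k} = ≡.subst (k ≤_) (≡.sym (ℕ.m+[n∸m]≡n m≤r))
      f : Vec A (suc (r ∸ m))
      f = proj₁ (interpolate (r ∸ m) m y)
      g : ℕ → A
      g k = falling R k m * eval R f (ι R k)

  B⇒C : CondB R r Binv P → CondC R r P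
  B⇒C condB = B⇒superdiagonal condB , B⇒subdiagonal condB

propositionB1 : ∀ {c ℓ : Level} (R : CommutativeRing c ℓ) → ContainsRationals R →
    (r : ℕ) (P : Matrix R (CommutativeRing.Carrier R)) →
    Banded R (IsZeroR R) r 1 P →
    (Binv : Matrix R (Poly R)) → LowerTriangular R Binv →
    (∀ i j → _≈P_ R ((_⋆ᴸ_ R Binv (Bξ R)) i j) (IdP R i j)) →
    (CondA R r Binv P ⇔ CondB R r Binv P) × (CondA R r Binv P ⇔ CondC R r P)
propositionB1 R ℚ⊆R r P banded Binv lower leftInverse =
  mk⇔ A⇒B (C⇒A ∘ B⇒C) , mk⇔ (B⇒C ∘ A⇒B) C⇒A
  where open Conditions R ℚ⊆R r P banded Binv lower leftInverse
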